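{- Let $\mathcal{A}_H$ be the Hall affine plane of order $q^2$ with defining polynomial $f(x)=x^2-rx-s$. (i) Let $\ell\in NBF$ and $\ell'\in BF$ be intersecting lines and let $A$ be a point of $\ell$ other than $\ell\cap\ell'$. Then there is a collineation $\phi$ of $\mathcal{A}_H$ mapping $\ell$ to the line $\mathbf y=\mathbf x\,(0,1)$, $\ell'$ to the vertical line $\mathbf x=\mathbf 0$, and $A$ to the point $((0,1),(s,r))$. (ii) Let $\ell\in BF$ and $\ell'\in NBF$ be intersecting lines and let $A$ be a point of $\ell$ other than $\ell\cap\ell'$. Then there is a collineation $\phi$ of $\mathcal{A}_H$ mapping $\ell$ to the vertical line $\mathbf x=\mathbf 0$, $\ell'$ to the line $\mathbf y=\mathbf x\,(0,1)$, and $A$ to the point $((0,0),(0,1))$.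
   Context: Let $F=F_q$ ($q$ a prime power) and $f(x)=x^2-rx-s$, $r,s\in F$, irreducible over $F$. The Hall system is $H=F^2$ with componentwise addition and multiplication $\mathbf a\mathbf b=(a_1b_1,a_2b_1)$ if $b_2=0$, and $\mathbf a\mathbf b=(a_1b_1-a_2b_2^{ -1}f(b_1),\,a_1b_2-a_2b_1+a_2r)$ if $b_2\neq0$; $\mathbf 0=(0,0)$. The Hall affine plane $\mathcal{A}_H$ has points $(\mathbf x,\mathbf y)\in H\times H$ and lines $\{(\mathbf x,\mathbf x\mathbf m+\mathbf k):\mathbf x\in H\}$ ($\mathbf m,\mathbf k\in H$; type 1 if $m_2=0$, type 2 if $m_2\neq0$) and vertical lines $\{(\mathbf c,\mathbf y):\mathbf y\in H\}$. $BF$ is the set of type 1 and vertical lines, $NBF$ the set of type 2 lines. A collineation is a bijection of the point set mapping lines onto lines. -}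

module Defs where

open import Level using (0ℓ)
open import Data.Nat using (ℕ)
open import Data.Fin using (Fin)
open import Data.Unit using (⊤)
open import Data.Empty using (⊥)
open import Data.Product using (Σ; ∃; _×_; _,_; proj₁; proj₂)
open import Relation.Nullary using (¬_; yes; no)
open import Relation.Binary.PropositionalEquality using (_≡_)
open import Relation.Binary.Definitions using (DecidableEquality)
open import Algebra.Structures using (IsCommutativeRing)
open import Function.Bundles using (_↔_; _⇔_)
open import Function.Definitions using (Bijective)

-- The inverse is a total function whose
-- value at 0 is irrelevant (only used at nonzero arguments).
record FiniteField : Set₁ where
  infixl 6 _+_ _-_
  infixl 7 _*_
  field
    Carrier    : Set
    _+_ _*_    : Carrier → Carrier → Carrier
    -_         : Carrier → Carrier
    0# 1#      : Carrier
    isCommutativeRing : IsCommutativeRing _≡_ _+_ _*_ -_ 0# 1#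
    0≢1        : ¬ (0# ≡ 1#)
    _⁻¹        : Carrier → Carrier
    ⁻¹-inverse : ∀ x → ¬ (x ≡ 0#) → x * (x ⁻¹) ≡ 1#
    _≟_        : DecidableEquality Carrier
    finite     : Σ ℕ (λ n → Carrier ↔ Fin n)
  _-_ : Carrier → Carrier → Carrier
  x - y = x + (- y)

module Hall (F : FiniteField) (r s : FiniteField.Carrier F) where
  open FiniteField F

  fpoly : Carrier → Carrier
  fpoly x = x * x - r * x - s

  -- Irreducibility of the monic quadratic x^2 - r x - s over F:
  -- it does not factor as (x - a)(x - b) = x^2 - (a+b) x + a b.
  Irreducible : Set
  Irreducible = ¬ (Σ Carrier λ a → Σ Carrier λ b → (a + b ≡ r) × (a * b ≡ - s))

  H : Set
  H = Carrier × Carrier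

  _⊕_ : H → H → H
  (a₁ , a₂) ⊕ (b₁ , b₂) = (a₁ + b₁ , a₂ + b₂)

  _⊙_ : H → H → H
  (a₁ , a₂) ⊙ (b₁ , b₂) with b₂ ≟ 0#
  ... | yes _ = (a₁ * b₁ , a₂ * b₁)
  ... | no  _ = (a₁ * b₁ - a₂ * (b₂ ⁻¹) * fpoly b₁ , a₁ * b₂ - a₂ * b₁ + a₂ * r)

  𝟎 : H
  𝟎 = (0# , 0#)

  Point : Set
  Point = H × H

  data Line : Set where
    line : (m k : H) → Line
    vert : (c : H) → Line

  OnLine : Point → Line → Set
  OnLine (x , y) (line m k) = y ≡ (x ⊙ m) ⊕ k
  OnLine (x , y) (vert c)   = x ≡ c

  InBF : Line → Set
  InBF (line m k) = proj₂ m ≡ 0#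
  InBF (vert c)   = ⊤

  InNBF : Line → Set
  InNBF (line m k) = ¬ (proj₂ m ≡ 0#)
  InNBF (vert c)   = ⊥

  Intersect : Line → Line → Set
  Intersect ℓ ℓ' = Σ Point λ P → OnLine P ℓ × OnLine P ℓ'

  MapsLine : (Point → Point) → Line → Line → Set
  MapsLine φ ℓ ℓ' = ∀ Q → OnLine Q ℓ' ⇔ (Σ Point λ P → OnLine P ℓ × φ P ≡ Q)

  IsCollineation : (Point → Point) → Set
  IsCollineation φ = Bijective _≡_ _≡_ φ × (∀ ℓ → Σ Line λ ℓ' → MapsLine φ ℓ ℓ')

  ℓ₀₁ : Line
  ℓ₀₁ = line (0# , 1#) 𝟎

  x=0 : Line
  x=0 = vert 𝟎

module Submission where

-- Write x ⊙ m = x N(m) for a 2×2 matrix N(m): the scalar matrix m₁ I when m₂ = 0, and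
-- otherwise a matrix with characteristic polynomial f, which is never scalar since f is
-- irreducible.  A line of direction d is a fibre of the intercept map along d (x for
-- vertical lines, y − x N(m) otherwise), so a bijection that transforms intercepts along
-- each direction injectively into intercepts along another direction is a collineation.
-- Three kinds of such maps suffice: translations; (x , y) ↦ (y − c x , s x + (r − c) y),
-- which fixes every non-Baer slope (as N² = r N + s) and makes the Baer slope c vertical;
-- and (x , y) ↦ (x P , y P), which conjugates slope matrices by P.  Translate the common
-- point to the origin, make the Baer line vertical, and finally conjugate by a P chosen so
-- that the non-Baer slope N and the relevant coordinate a of the image of A are both sent
-- to (0 , 1); such a P exists because a and a N are independent, N having no eigenvector.

open import Defs
open import Data.Product using (Σ; _×_; _,_; proj₁; proj₂)
open import Relation.Nullary using (¬_; yes; no; Dec; contradiction)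
open import Function.Bundles using (mk⇔)
open import Relation.Binary.PropositionalEquality using (_≡_; refl; sym; trans; cong; cong₂; subst; module ≡-Reasoning)

open import Level using (0ℓ)
open import Algebra.Bundles using (CommutativeRing)
open import Algebra.Solver.Ring.AlmostCommutativeRing using (fromCommutativeRing; _-Raw-AlmostCommutative⟶_)
open import Data.Nat as ℕ using (zero; suc)
open import Data.Integer as ℤ using (ℤ; -[1+_])
import Data.Integer.Properties as ℤ
import Data.Nat.Properties as ℕ
open import Data.Sign as Sign using (Sign)
open import Data.Maybe as Maybe using (Maybe)
open import Data.Sum using (_⊎_; inj₁; inj₂)
open import Relation.Nullary.Decidable using (dec⇒maybe)

-- The ring solver needs coefficients with a computable equality, which the abstract
-- carrier of F lacks; coefficients are therefore taken in ℤ, mapped canonically into F.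
module IntegerCoefficients (F : FiniteField) where
  open FiniteField F

  commutativeRing : CommutativeRing 0ℓ 0ℓ
  commutativeRing = record { isCommutativeRing = isCommutativeRing }

  open CommutativeRing commutativeRing
    using (+-assoc; +-comm; +-identityˡ; +-identityʳ; -‿inverseʳ; ring; semiring)
  open import Algebra.Properties.Ring ring
    using (-‿involutive; -0#≈0#; -‿distribˡ-*; -‿distribʳ-*; -‿+-comm)
  open import Algebra.Properties.Semiring.Mult.TCOptimised semiring
    using (×-homo-+; ×1-homo-*) renaming (_×_ to _×ᵣ_)
  open ≡-Reasoning

  applySign : Sign → Carrier → Carrier
  applySign Sign.+ x = x
  applySign Sign.- x = - x

  ⟦_⟧ : ℤ → Carrier
  ⟦ i ⟧ = applySign (ℤ.sign i) (ℤ.∣ i ∣ ×ᵣ 1#)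

  applySign-◃ : ∀ σ n → ⟦ σ ℤ.◃ n ⟧ ≡ applySign σ (n ×ᵣ 1#)
  applySign-◃ Sign.+ zero    = refl
  applySign-◃ Sign.- zero    = sym -0#≈0#
  applySign-◃ Sign.+ (suc n) = refl
  applySign-◃ Sign.- (suc n) = refl

  applySign-* : ∀ σ τ a b → applySign (σ Sign.* τ) (a * b) ≡ applySign σ a * applySign τ b
  applySign-* Sign.+ Sign.+ a b = refl
  applySign-* Sign.+ Sign.- a b = -‿distribʳ-* a b
  applySign-* Sign.- Sign.+ a b = -‿distribˡ-* a b
  applySign-* Sign.- Sign.- a b = begin
    a * b           ≡⟨ cong (_* b) (-‿involutive a) ⟨
    - - a * b   ≡⟨ -‿distribˡ-* (- a) b ⟨
    - (- a * b) ≡⟨ -‿distribʳ-* (- a) b ⟩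
    - a * - b   ∎

  *-homo : ∀ i j → ⟦ i ℤ.* j ⟧ ≡ ⟦ i ⟧ * ⟦ j ⟧
  *-homo i j = begin
    ⟦ i ℤ.* j ⟧
      ≡⟨ applySign-◃ (ℤ.sign i Sign.* ℤ.sign j) (ℤ.∣ i ∣ ℕ.* ℤ.∣ j ∣) ⟩
    applySign (ℤ.sign i Sign.* ℤ.sign j) ((ℤ.∣ i ∣ ℕ.* ℤ.∣ j ∣) ×ᵣ 1#)
      ≡⟨ cong (applySign (ℤ.sign i Sign.* ℤ.sign j)) (×1-homo-* ℤ.∣ i ∣ ℤ.∣ j ∣) ⟩
    applySign (ℤ.sign i Sign.* ℤ.sign j) ((ℤ.∣ i ∣ ×ᵣ 1#) * (ℤ.∣ j ∣ ×ᵣ 1#))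
      ≡⟨ applySign-* (ℤ.sign i) (ℤ.sign j) _ _ ⟩
    ⟦ i ⟧ * ⟦ j ⟧ ∎

  suc-minus-suc : ∀ m n → (suc m ×ᵣ 1#) - (suc n ×ᵣ 1#) ≡ (m ×ᵣ 1#) - (n ×ᵣ 1#)
  suc-minus-suc m n = begin
    (suc m ×ᵣ 1#) - (suc n ×ᵣ 1#)  ≡⟨ cong₂ _-_ (×-homo-+ 1# 1 m) (×-homo-+ 1# 1 n) ⟩
    (1# + a) + - (1# + b)   ≡⟨ cong ((1# + a) +_) (-‿+-comm 1# b) ⟨
    (1# + a) + (- 1# + - b) ≡⟨ +-assoc 1# a _ ⟩
    1# + (a + (- 1# + - b)) ≡⟨ cong (1# +_) (trans (sym (+-assoc a _ _)) (cong (_+ - b) (+-comm a (- 1#)))) ⟩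
    1# + ((- 1# + a) + - b) ≡⟨ trans (cong (1# +_) (+-assoc _ _ _)) (sym (+-assoc _ _ _)) ⟩
    (1# + - 1#) + (a - b)   ≡⟨ cong (_+ (a - b)) (-‿inverseʳ 1#) ⟩
    0# + (a - b)            ≡⟨ +-identityˡ _ ⟩
    a - b                   ∎
    where a = m ×ᵣ 1#; b = n ×ᵣ 1#

  ⊖-homo : ∀ m n → ⟦ m ℤ.⊖ n ⟧ ≡ (m ×ᵣ 1#) - (n ×ᵣ 1#)
  ⊖-homo zero    zero    = sym (-‿inverseʳ 0#)
  ⊖-homo zero    (suc n) = sym (+-identityˡ _)
  ⊖-homo (suc m) zero    = sym (trans (cong ((suc m ×ᵣ 1#) +_) -0#≈0#) (+-identityʳ _))
  ⊖-homo (suc m) (suc n) = begin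
    ⟦ suc m ℤ.⊖ suc n ⟧         ≡⟨ cong ⟦_⟧ (ℤ.[1+m]⊖[1+n]≡m⊖n m n) ⟩
    ⟦ m ℤ.⊖ n ⟧                 ≡⟨ ⊖-homo m n ⟩
    (m ×ᵣ 1#) - (n ×ᵣ 1#)         ≡⟨ suc-minus-suc m n ⟨
    (suc m ×ᵣ 1#) - (suc n ×ᵣ 1#) ∎

  +-homo : ∀ i j → ⟦ i ℤ.+ j ⟧ ≡ ⟦ i ⟧ + ⟦ j ⟧
  +-homo (ℤ.+ m)  (ℤ.+ n)  = ×-homo-+ 1# m n
  +-homo (ℤ.+ m)  -[1+ n ] = ⊖-homo m (suc n)
  +-homo -[1+ m ] (ℤ.+ n)  = trans (⊖-homo n (suc m)) (+-comm _ _)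
  +-homo -[1+ m ] -[1+ n ] = begin
    - (suc (suc m ℕ.+ n) ×ᵣ 1#)            ≡⟨ cong (λ k → - (k ×ᵣ 1#)) (ℕ.+-suc (suc m) n) ⟨
    - ((suc m ℕ.+ suc n) ×ᵣ 1#)            ≡⟨ cong -_ (×-homo-+ 1# (suc m) (suc n)) ⟩
    - ((suc m ×ᵣ 1#) + (suc n ×ᵣ 1#))       ≡⟨ -‿+-comm _ _ ⟨
    - (suc m ×ᵣ 1#) + - (suc n ×ᵣ 1#)       ∎

  -‿homo : ∀ i → ⟦ ℤ.- i ⟧ ≡ - ⟦ i ⟧
  -‿homo (ℤ.+ zero)  = sym -0#≈0#
  -‿homo (ℤ.+ suc n) = refl
  -‿homo -[1+ n ]    = sym (-‿involutive _)

  homomorphism : CommutativeRing.rawRing ℤ.+-*-commutativeRing -Raw-AlmostCommutative⟶ fromCommutativeRing commutativeRing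
  homomorphism = record
    { ⟦_⟧ = ⟦_⟧ ; +-homo = +-homo ; *-homo = *-homo ; -‿homo = -‿homo
    ; 0-homo = refl ; 1-homo = refl }

  ⟦⟧-≟ : ∀ i j → Maybe (⟦ i ⟧ ≡ ⟦ j ⟧)
  ⟦⟧-≟ i j = Maybe.map (cong ⟦_⟧) (dec⇒maybe (i ℤ.≟ j))

  import Algebra.Solver.Ring _ _ homomorphism ⟦⟧-≟ as Solver
  open Solver public using (solve; _:=_; _:+_; _:*_; _:-_; :-_)

  :0 :1 : ∀ {n} → Solver.Polynomial n
  :0 = Solver.con ℤ.0ℤ
  :1 = Solver.con ℤ.1ℤ

module FieldArithmetic (F : FiniteField) where
  open FiniteField F
  open IntegerCoefficients F public using (solve; _:=_; _:+_; _:*_; _:-_; :-_; :0; :1)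
  open ≡-Reasoning

  -- An identity that only holds given t = u is reduced to the polynomial identity
  -- a = b + q (t − u), which the solver checks.
  ≡-modulo : ∀ {a b q t u} → a ≡ b + q * (t - u) → t ≡ u → a ≡ b
  ≡-modulo {b = b} {q} {u = u} a≡ refl = trans a≡ (vanish b q u)
    where
    vanish : ∀ b q u → b + q * (u - u) ≡ b
    vanish = solve 3 (λ b q u → b :+ q :* (u :- u) := b) refl

  ⁻¹-inverseˡ : ∀ x → ¬ x ≡ 0# → x ⁻¹ * x ≡ 1#
  ⁻¹-inverseˡ x x≢0 = trans (*-comm (x ⁻¹) x) (⁻¹-inverse x x≢0)
    where
    *-comm : ∀ x y → x * y ≡ y * x
    *-comm = solve 2 (λ x y → x :* y := y :* x) refl

  *-cancelˡ : ∀ {z x y} → ¬ z ≡ 0# → z * x ≡ z * y → x ≡ y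
  *-cancelˡ {z} {x} {y} z≢0 zx≡zy = begin
    x               ≡⟨ ≡-modulo (expand x z (z ⁻¹)) (sym (⁻¹-inverse z z≢0)) ⟩
    z ⁻¹ * (z * x)  ≡⟨ cong (z ⁻¹ *_) zx≡zy ⟩
    z ⁻¹ * (z * y)  ≡⟨ ≡-modulo (expand y z (z ⁻¹)) (sym (⁻¹-inverse z z≢0)) ⟨
    y               ∎
    where
    expand : ∀ w z i → w ≡ i * (z * w) + w * (1# - z * i)
    expand = solve 3 (λ w z i → w := i :* (z :* w) :+ w :* (:1 :- z :* i)) refl

  sub-cancelʳ : ∀ {x y z} → x - z ≡ y - z → x ≡ y
  sub-cancelʳ {x} {y} {z} x-z≡y-z = begin
    x            ≡⟨ add-back x z ⟩
    (x - z) + z  ≡⟨ cong (_+ z) x-z≡y-z ⟩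
    (y - z) + z  ≡⟨ add-back y z ⟨
    y            ∎
    where
    add-back : ∀ x z → x ≡ (x - z) + z
    add-back = solve 2 (λ x z → x := (x :- z) :+ z) refl

  zeroʳ : ∀ x → x * 0# ≡ 0#
  zeroʳ = solve 1 (λ x → x :* :0 := :0) refl

  nonzero-*-zero : ∀ {x y} → ¬ x ≡ 0# → x * y ≡ 0# → y ≡ 0#
  nonzero-*-zero {x} x≢0 xy≡0 = *-cancelˡ x≢0 (trans xy≡0 (sym (zeroʳ x)))

  *-nonzero : ∀ {x y} → ¬ x ≡ 0# → ¬ y ≡ 0# → ¬ x * y ≡ 0#
  *-nonzero x≢0 y≢0 xy≡0 = y≢0 (nonzero-*-zero x≢0 xy≡0)

  ⁻¹-nonzero : ∀ {x} → ¬ x ≡ 0# → ¬ x ⁻¹ ≡ 0#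
  ⁻¹-nonzero {x} x≢0 x⁻¹≡0 = 0≢1 (begin
    0#         ≡⟨ zeroʳ x ⟨
    x * 0#     ≡⟨ cong (x *_) x⁻¹≡0 ⟨
    x * x ⁻¹   ≡⟨ ⁻¹-inverse x x≢0 ⟩
    1#         ∎)

  -‿nonzero : ∀ {x} → ¬ x ≡ 0# → ¬ - x ≡ 0#
  -‿nonzero {x} x≢0 -x≡0 = x≢0 (trans (negate-twice x) (trans (cong -_ -x≡0) -0#≡0#))
    where
    negate-twice : ∀ x → x ≡ - - x
    negate-twice = solve 1 (λ x → x := :- (:- x)) refl
    -0#≡0# : - 0# ≡ 0#
    -0#≡0# = solve 0 (:- :0 := :0) refl

module Matrices (F : FiniteField) where
  open FiniteField F
  open FieldArithmetic F

  Vector : Set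
  Vector = Carrier × Carrier

  infixl 6 _⊖_
  _⊖_ : Vector → Vector → Vector
  (a₁ , a₂) ⊖ (b₁ , b₂) = (a₁ - b₁ , a₂ - b₂)

  infixr 7 _·_
  _·_ : Carrier → Vector → Vector
  k · (a₁ , a₂) = (k * a₁ , k * a₂)

  ⊖-cancelʳ : ∀ w {u v} → u ⊖ w ≡ v ⊖ w → u ≡ v
  ⊖-cancelʳ w u⊖w≡v⊖w = cong₂ _,_ (sub-cancelʳ (cong proj₁ u⊖w≡v⊖w)) (sub-cancelʳ (cong proj₂ u⊖w≡v⊖w))

  ⊖-interchange : ∀ u v w z → (u ⊖ v) ⊖ (w ⊖ z) ≡ (u ⊖ w) ⊖ (v ⊖ z)
  ⊖-interchange (u₁ , u₂) (v₁ , v₂) (w₁ , w₂) (z₁ , z₂) = cong₂ _,_ (identity u₁ v₁ w₁ z₁) (identity u₂ v₂ w₂ z₂)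
    where
    identity : ∀ u v w z → (u - v) - (w - z) ≡ (u - w) - (v - z)
    identity = solve 4 (λ u v w z → (u :- v) :- (w :- z) := (u :- w) :- (v :- z)) refl

  record Matrix : Set where
    constructor mat
    field m₁₁ m₁₂ m₂₁ m₂₂ : Carrier

  mat-cong : ∀ {a b c d a' b' c' d'} → a ≡ a' → b ≡ b' → c ≡ c' → d ≡ d' →
             mat a b c d ≡ mat a' b' c' d'
  mat-cong refl refl refl refl = refl

  infixl 7 _⋆_ _*ᴹ_
  _⋆_ : Vector → Matrix → Vector
  (x₁ , x₂) ⋆ mat a b c d = (x₁ * a + x₂ * c , x₁ * b + x₂ * d)

  _*ᴹ_ : Matrix → Matrix → Matrix
  mat a b c d *ᴹ mat a' b' c' d' =
    mat (a * a' + b * c') (a * b' + b * d') (c * a' + d * c') (c * b' + d * d')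

  scalarᴹ : Carrier → Matrix
  scalarᴹ k = mat k 0# 0# k

  1ᴹ : Matrix
  1ᴹ = scalarᴹ 1#

  trace : Matrix → Carrier
  trace (mat a b c d) = a + d

  det : Matrix → Carrier
  det (mat a b c d) = a * d - b * c

  infixl 6 _-ᴹ_
  _-ᴹ_ : Matrix → Matrix → Matrix
  mat a b c d -ᴹ mat a' b' c' d' = mat (a - a') (b - b') (c - c') (d - d')

  fromRows : Vector → Vector → Matrix
  fromRows (a , b) (c , d) = mat a b c d

  row₁ row₂ : Matrix → Vector
  row₁ (mat a b c d) = (a , b)
  row₂ (mat a b c d) = (c , d)

  row₁-*ᴹ : ∀ A B → row₁ (A *ᴹ B) ≡ row₁ A ⋆ B
  row₁-*ᴹ (mat a b c d) B = refl

  row₂-*ᴹ : ∀ A B → row₂ (A *ᴹ B) ≡ row₂ A ⋆ B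
  row₂-*ᴹ (mat a b c d) B = refl

  _⁻¹ᴹ : Matrix → Matrix
  Q@(mat a b c d) ⁻¹ᴹ = mat (det Q ⁻¹ * d) (det Q ⁻¹ * - b) (det Q ⁻¹ * - c) (det Q ⁻¹ * a)

  ⋆-assoc : ∀ x A B → x ⋆ A ⋆ B ≡ x ⋆ (A *ᴹ B)
  ⋆-assoc (x₁ , x₂) (mat a b c d) (mat a' b' c' d') = cong₂ _,_ (column a' c') (column b' d')
    where
    column : ∀ p q → (x₁ * a + x₂ * c) * p + (x₁ * b + x₂ * d) * q ≡ x₁ * (a * p + b * q) + x₂ * (c * p + d * q)
    column = solve 8 (λ x₁ x₂ a b c d p q → (x₁ :* a :+ x₂ :* c) :* p :+ (x₁ :* b :+ x₂ :* d) :* q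
                                          := x₁ :* (a :* p :+ b :* q) :+ x₂ :* (c :* p :+ d :* q)) refl x₁ x₂ a b c d

  ⋆-scalarᴹ : ∀ x k → x ⋆ scalarᴹ k ≡ k · x
  ⋆-scalarᴹ (x₁ , x₂) k = cong₂ _,_ (first x₁ x₂ k) (second x₁ x₂ k)
    where
    first : ∀ x₁ x₂ k → x₁ * k + x₂ * 0# ≡ k * x₁
    first = solve 3 (λ x₁ x₂ k → x₁ :* k :+ x₂ :* :0 := k :* x₁) refl
    second : ∀ x₁ x₂ k → x₁ * 0# + x₂ * k ≡ k * x₂
    second = solve 3 (λ x₁ x₂ k → x₁ :* :0 :+ x₂ :* k := k :* x₂) refl

  ⋆-identityʳ : ∀ x → x ⋆ 1ᴹ ≡ x
  ⋆-identityʳ (x₁ , x₂) = trans (⋆-scalarᴹ (x₁ , x₂) 1#) (cong₂ _,_ (*-identityˡ x₁) (*-identityˡ x₂))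
    where
    *-identityˡ : ∀ x → 1# * x ≡ x
    *-identityˡ = solve 1 (λ x → :1 :* x := x) refl

  ·-⋆ : ∀ k x N → (k · x) ⋆ N ≡ k · (x ⋆ N)
  ·-⋆ k (x₁ , x₂) (mat a b c d) = cong₂ _,_ (column a c) (column b d)
    where
    column : ∀ p q → (k * x₁) * p + (k * x₂) * q ≡ k * (x₁ * p + x₂ * q)
    column = solve 5 (λ k x₁ x₂ p q → (k :* x₁) :* p :+ (k :* x₂) :* q := k :* (x₁ :* p :+ x₂ :* q)) refl k x₁ x₂

  ⊖-⋆ : ∀ x y N → (x ⊖ y) ⋆ N ≡ x ⋆ N ⊖ y ⋆ N
  ⊖-⋆ (x₁ , x₂) (y₁ , y₂) (mat a b c d) = cong₂ _,_ (column a c) (column b d)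
    where
    column : ∀ p q → (x₁ - y₁) * p + (x₂ - y₂) * q ≡ (x₁ * p + x₂ * q) - (y₁ * p + y₂ * q)
    column = solve 6 (λ x₁ x₂ y₁ y₂ p q → (x₁ :- y₁) :* p :+ (x₂ :- y₂) :* q
                                        := (x₁ :* p :+ x₂ :* q) :- (y₁ :* p :+ y₂ :* q)) refl x₁ x₂ y₁ y₂

  trace-cycle : ∀ Q M P → trace (Q *ᴹ M *ᴹ P) ≡ trace (M *ᴹ (P *ᴹ Q))
  trace-cycle (mat q₁ q₂ q₃ q₄) (mat m₁ m₂ m₃ m₄) (mat p₁ p₂ p₃ p₄) = identity q₁ q₂ q₃ q₄ m₁ m₂ m₃ m₄ p₁ p₂ p₃ p₄
    where
    identity : ∀ q₁ q₂ q₃ q₄ m₁ m₂ m₃ m₄ p₁ p₂ p₃ p₄ →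
      ((q₁ * m₁ + q₂ * m₃) * p₁ + (q₁ * m₂ + q₂ * m₄) * p₃) + ((q₃ * m₁ + q₄ * m₃) * p₂ + (q₃ * m₂ + q₄ * m₄) * p₄)
      ≡ (m₁ * (p₁ * q₁ + p₂ * q₃) + m₂ * (p₃ * q₁ + p₄ * q₃)) + (m₃ * (p₁ * q₂ + p₂ * q₄) + m₄ * (p₃ * q₂ + p₄ * q₄))
    identity = solve 12 (λ q₁ q₂ q₃ q₄ m₁ m₂ m₃ m₄ p₁ p₂ p₃ p₄ →
      ((q₁ :* m₁ :+ q₂ :* m₃) :* p₁ :+ (q₁ :* m₂ :+ q₂ :* m₄) :* p₃) :+ ((q₃ :* m₁ :+ q₄ :* m₃) :* p₂ :+ (q₃ :* m₂ :+ q₄ :* m₄) :* p₄)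
      := (m₁ :* (p₁ :* q₁ :+ p₂ :* q₃) :+ m₂ :* (p₃ :* q₁ :+ p₄ :* q₃)) :+ (m₃ :* (p₁ :* q₂ :+ p₂ :* q₄) :+ m₄ :* (p₃ :* q₂ :+ p₄ :* q₄))) refl

  det-cycle : ∀ Q M P → det (Q *ᴹ M *ᴹ P) ≡ det M * det (P *ᴹ Q)
  det-cycle (mat q₁ q₂ q₃ q₄) (mat m₁ m₂ m₃ m₄) (mat p₁ p₂ p₃ p₄) = identity q₁ q₂ q₃ q₄ m₁ m₂ m₃ m₄ p₁ p₂ p₃ p₄
    where
    identity : ∀ q₁ q₂ q₃ q₄ m₁ m₂ m₃ m₄ p₁ p₂ p₃ p₄ →
      ((q₁ * m₁ + q₂ * m₃) * p₁ + (q₁ * m₂ + q₂ * m₄) * p₃) * ((q₃ * m₁ + q₄ * m₃) * p₂ + (q₃ * m₂ + q₄ * m₄) * p₄)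
        - ((q₁ * m₁ + q₂ * m₃) * p₂ + (q₁ * m₂ + q₂ * m₄) * p₄) * ((q₃ * m₁ + q₄ * m₃) * p₁ + (q₃ * m₂ + q₄ * m₄) * p₃)
      ≡ (m₁ * m₄ - m₂ * m₃) * ((p₁ * q₁ + p₂ * q₃) * (p₃ * q₂ + p₄ * q₄) - (p₁ * q₂ + p₂ * q₄) * (p₃ * q₁ + p₄ * q₃))
    identity = solve 12 (λ q₁ q₂ q₃ q₄ m₁ m₂ m₃ m₄ p₁ p₂ p₃ p₄ →
      ((q₁ :* m₁ :+ q₂ :* m₃) :* p₁ :+ (q₁ :* m₂ :+ q₂ :* m₄) :* p₃) :* ((q₃ :* m₁ :+ q₄ :* m₃) :* p₂ :+ (q₃ :* m₂ :+ q₄ :* m₄) :* p₄)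
        :- ((q₁ :* m₁ :+ q₂ :* m₃) :* p₂ :+ (q₁ :* m₂ :+ q₂ :* m₄) :* p₄) :* ((q₃ :* m₁ :+ q₄ :* m₃) :* p₁ :+ (q₃ :* m₂ :+ q₄ :* m₄) :* p₃)
      := (m₁ :* m₄ :- m₂ :* m₃) :* ((p₁ :* q₁ :+ p₂ :* q₃) :* (p₃ :* q₂ :+ p₄ :* q₄) :- (p₁ :* q₂ :+ p₂ :* q₄) :* (p₃ :* q₁ :+ p₄ :* q₃))) refl

  trace-conjugate : ∀ {P Q} → P *ᴹ Q ≡ 1ᴹ → ∀ M → trace (Q *ᴹ M *ᴹ P) ≡ trace M
  trace-conjugate {P} {Q} PQ≡1 M@(mat a b c d) = trans (trace-cycle Q M P) (trans (cong (λ N → trace (M *ᴹ N)) PQ≡1) (identity a b c d))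
    where
    identity : ∀ a b c d → (a * 1# + b * 0#) + (c * 0# + d * 1#) ≡ a + d
    identity = solve 4 (λ a b c d → (a :* :1 :+ b :* :0) :+ (c :* :0 :+ d :* :1) := a :+ d) refl

  det-conjugate : ∀ {P Q} → P *ᴹ Q ≡ 1ᴹ → ∀ M → det (Q *ᴹ M *ᴹ P) ≡ det M
  det-conjugate {P} {Q} PQ≡1 M = trans (det-cycle Q M P) (trans (cong (λ N → det M * det N) PQ≡1) (identity (det M)))
    where
    identity : ∀ x → x * (1# * 1# - 0# * 0#) ≡ x
    identity = solve 1 (λ x → x :* (:1 :* :1 :- :0 :* :0) := x) refl

  *ᴹ-inverseˡ : ∀ Q → ¬ det Q ≡ 0# → Q ⁻¹ᴹ *ᴹ Q ≡ 1ᴹ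
  *ᴹ-inverseˡ Q@(mat a b c d) det≢0 = mat-cong
    (trans (entry₁₁ a b c d (det Q ⁻¹)) (⁻¹-inverseˡ (det Q) det≢0)) (entry₁₂ a b c d (det Q ⁻¹))
    (entry₂₁ a b c d (det Q ⁻¹)) (trans (entry₂₂ a b c d (det Q ⁻¹)) (⁻¹-inverseˡ (det Q) det≢0))
    where
    entry₁₁ : ∀ a b c d i → (i * d) * a + (i * - b) * c ≡ i * (a * d - b * c)
    entry₁₁ = solve 5 (λ a b c d i → (i :* d) :* a :+ (i :* :- b) :* c := i :* (a :* d :- b :* c)) refl
    entry₁₂ : ∀ a b c d i → (i * d) * b + (i * - b) * d ≡ 0#
    entry₁₂ = solve 5 (λ a b c d i → (i :* d) :* b :+ (i :* :- b) :* d := :0) refl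
    entry₂₁ : ∀ a b c d i → (i * - c) * a + (i * a) * c ≡ 0#
    entry₂₁ = solve 5 (λ a b c d i → (i :* :- c) :* a :+ (i :* a) :* c := :0) refl
    entry₂₂ : ∀ a b c d i → (i * - c) * b + (i * a) * d ≡ i * (a * d - b * c)
    entry₂₂ = solve 5 (λ a b c d i → (i :* :- c) :* b :+ (i :* a) :* d := i :* (a :* d :- b :* c)) refl

  *ᴹ-inverseʳ : ∀ Q → ¬ det Q ≡ 0# → Q *ᴹ Q ⁻¹ᴹ ≡ 1ᴹ
  *ᴹ-inverseʳ Q@(mat a b c d) det≢0 = mat-cong
    (trans (entry₁₁ a b c d (det Q ⁻¹)) (⁻¹-inverseˡ (det Q) det≢0)) (entry₁₂ a b c d (det Q ⁻¹))
    (entry₂₁ a b c d (det Q ⁻¹)) (trans (entry₂₂ a b c d (det Q ⁻¹)) (⁻¹-inverseˡ (det Q) det≢0))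
    where
    entry₁₁ : ∀ a b c d i → a * (i * d) + b * (i * - c) ≡ i * (a * d - b * c)
    entry₁₁ = solve 5 (λ a b c d i → a :* (i :* d) :+ b :* (i :* :- c) := i :* (a :* d :- b :* c)) refl
    entry₁₂ : ∀ a b c d i → a * (i * - b) + b * (i * a) ≡ 0#
    entry₁₂ = solve 5 (λ a b c d i → a :* (i :* :- b) :+ b :* (i :* a) := :0) refl
    entry₂₁ : ∀ a b c d i → c * (i * d) + d * (i * - c) ≡ 0#
    entry₂₁ = solve 5 (λ a b c d i → c :* (i :* d) :+ d :* (i :* :- c) := :0) refl
    entry₂₂ : ∀ a b c d i → c * (i * - b) + d * (i * a) ≡ i * (a * d - b * c)
    entry₂₂ = solve 5 (λ a b c d i → c :* (i :* :- b) :+ d :* (i :* a) := i :* (a :* d :- b :* c)) refl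

  ⋆-inverse : ∀ {P Q} → P *ᴹ Q ≡ 1ᴹ → ∀ x → x ⋆ P ⋆ Q ≡ x
  ⋆-inverse {P} {Q} PQ≡1 x = trans (⋆-assoc x P Q) (trans (cong (x ⋆_) PQ≡1) (⋆-identityʳ x))

  ⋆-cancelʳ : ∀ {P Q} → P *ᴹ Q ≡ 1ᴹ → ∀ x y → x ⋆ P ≡ y ⋆ P → x ≡ y
  ⋆-cancelʳ {P} {Q} PQ≡1 x y xP≡yP =
    trans (sym (⋆-inverse PQ≡1 x)) (trans (cong (_⋆ Q) xP≡yP) (⋆-inverse PQ≡1 y))

  ⋆-injective : ∀ N → ¬ det N ≡ 0# → ∀ x y → x ⋆ N ≡ y ⋆ N → x ≡ y
  ⋆-injective N det≢0 = ⋆-cancelʳ (*ᴹ-inverseʳ N det≢0)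

  det-scalarᴹ : ∀ k → det (scalarᴹ k) ≡ k * k
  det-scalarᴹ = solve 1 (λ k → k :* k :- :0 :* :0 := k :* k) refl

  scalarᴹ-det-nonzero : ∀ {k} → ¬ k ≡ 0# → ¬ det (scalarᴹ k) ≡ 0#
  scalarᴹ-det-nonzero {k} k≢0 det≡0 = *-nonzero k≢0 k≢0 (trans (sym (det-scalarᴹ k)) det≡0)

  det-characteristic : ∀ t N → det (scalarᴹ t -ᴹ N) ≡ t * t - trace N * t + det N
  det-characteristic t (mat a b c d) = identity t a b c d
    where
    identity : ∀ t a b c d → (t - a) * (t - d) - (0# - b) * (0# - c) ≡ t * t - (a + d) * t + (a * d - b * c)
    identity = solve 5 (λ t a b c d → (t :- a) :* (t :- d) :- (:0 :- b) :* (:0 :- c)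
                                   := t :* t :- (a :+ d) :* t :+ (a :* d :- b :* c)) refl

module HallSystem (F : FiniteField) (r s : FiniteField.Carrier F) where
  open FiniteField F
  open Hall F r s
  open FieldArithmetic F
  open Matrices F

  companion : Carrier → Carrier → Matrix
  companion m₁ m₂ = mat m₁ m₂ (- (m₂ ⁻¹ * fpoly m₁)) (r - m₁)

  slopeMatrix : H → Matrix
  slopeMatrix (m₁ , m₂) with m₂ ≟ 0#
  ... | yes _ = scalarᴹ m₁
  ... | no  _ = companion m₁ m₂

  ⊙-⋆ : ∀ x m → x ⊙ m ≡ x ⋆ slopeMatrix m
  ⊙-⋆ (x₁ , x₂) (m₁ , m₂) with m₂ ≟ 0#
  ... | yes _ = cong₂ _,_ (baer₁ x₁ x₂ m₁) (baer₂ x₁ x₂ m₁)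
    where
    baer₁ : ∀ x₁ x₂ m₁ → x₁ * m₁ ≡ x₁ * m₁ + x₂ * 0#
    baer₁ = solve 3 (λ x₁ x₂ m₁ → x₁ :* m₁ := x₁ :* m₁ :+ x₂ :* :0) refl
    baer₂ : ∀ x₁ x₂ m₁ → x₂ * m₁ ≡ x₁ * 0# + x₂ * m₁
    baer₂ = solve 3 (λ x₁ x₂ m₁ → x₂ :* m₁ := x₁ :* :0 :+ x₂ :* m₁) refl
  ... | no  _ = cong₂ _,_ (nonBaer₁ x₁ x₂ m₁ (m₂ ⁻¹) (fpoly m₁)) (nonBaer₂ x₁ x₂ m₁ m₂ r)
    where
    nonBaer₁ : ∀ x₁ x₂ m₁ i φ → x₁ * m₁ - x₂ * i * φ ≡ x₁ * m₁ + x₂ * - (i * φ)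
    nonBaer₁ = solve 5 (λ x₁ x₂ m₁ i φ → x₁ :* m₁ :- x₂ :* i :* φ := x₁ :* m₁ :+ x₂ :* :- (i :* φ)) refl
    nonBaer₂ : ∀ x₁ x₂ m₁ m₂ r → x₁ * m₂ - x₂ * m₁ + x₂ * r ≡ x₁ * m₂ + x₂ * (r - m₁)
    nonBaer₂ = solve 5 (λ x₁ x₂ m₁ m₂ r → x₁ :* m₂ :- x₂ :* m₁ :+ x₂ :* r := x₁ :* m₂ :+ x₂ :* (r :- m₁)) refl

  slopeMatrix-baer : ∀ m₁ {m₂} → m₂ ≡ 0# → slopeMatrix (m₁ , m₂) ≡ scalarᴹ m₁
  slopeMatrix-baer m₁ {m₂} m₂≡0 with m₂ ≟ 0#
  ... | yes _    = refl
  ... | no m₂≢0 = contradiction m₂≡0 m₂≢0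

  slopeMatrix-nonBaer : ∀ m₁ {m₂} → ¬ m₂ ≡ 0# → slopeMatrix (m₁ , m₂) ≡ companion m₁ m₂
  slopeMatrix-nonBaer m₁ {m₂} m₂≢0 with m₂ ≟ 0#
  ... | yes m₂≡0 = contradiction m₂≡0 m₂≢0
  ... | no _     = refl

  record HasCharPolyF (N : Matrix) : Set where
    field
      trace≡r  : trace N ≡ r
      det≡-s   : det N ≡ - s

  companion-hasCharPolyF : ∀ m₁ {m₂} → ¬ m₂ ≡ 0# → HasCharPolyF (companion m₁ m₂)
  companion-hasCharPolyF m₁ {m₂} m₂≢0 = record
    { trace≡r = add-sub m₁ r
    ; det≡-s  = ≡-modulo (identity m₁ m₂ (m₂ ⁻¹) r s) (sym (⁻¹-inverse m₂ m₂≢0)) }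
    where
    add-sub : ∀ a b → a + (b - a) ≡ b
    add-sub = solve 2 (λ a b → a :+ (b :- a) := b) refl
    identity : ∀ m₁ m₂ i r s → m₁ * (r - m₁) - m₂ * - (i * (m₁ * m₁ - r * m₁ - s))
                             ≡ - s + (- (m₁ * m₁ - r * m₁ - s)) * (1# - m₂ * i)
    identity = solve 5 (λ m₁ m₂ i r s → m₁ :* (r :- m₁) :- m₂ :* :- (i :* (m₁ :* m₁ :- r :* m₁ :- s))
                                     := :- s :+ (:- (m₁ :* m₁ :- r :* m₁ :- s)) :* (:1 :- m₂ :* i)) refl

  slopeMatrix-row₁ : ∀ N → ¬ Matrix.m₁₂ N ≡ 0# → HasCharPolyF N → slopeMatrix (row₁ N) ≡ N
  slopeMatrix-row₁ (mat a b c d) b≢0 χ = trans (slopeMatrix-nonBaer a b≢0) (mat-cong refl refl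
    (≡-modulo (≡-modulo (≡-modulo (third-entry a b c d (b ⁻¹) r s) det≡-s) trace≡r) (sym (⁻¹-inverseˡ b b≢0)))
    (≡-modulo (fourth-entry a d r) trace≡r))
    where
    open HasCharPolyF χ
    third-entry : ∀ a b c d i r s → - (i * (a * a - r * a - s))
      ≡ ((c + (- c) * (1# - i * b)) + (- (i * a)) * ((a + d) - r)) + i * ((a * d - b * c) - - s)
    third-entry = solve 7 (λ a b c d i r s → :- (i :* (a :* a :- r :* a :- s))
      := ((c :+ (:- c) :* (:1 :- i :* b)) :+ (:- (i :* a)) :* ((a :+ d) :- r)) :+ i :* ((a :* d :- b :* c) :- :- s)) refl
    fourth-entry : ∀ a d r → r - a ≡ d + (- 1#) * ((a + d) - r)
    fourth-entry = solve 3 (λ a d r → r :- a := d :+ (:- :1) :* ((a :+ d) :- r)) refl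

  cayley-hamilton : ∀ {N} → HasCharPolyF N → ∀ x → x ⋆ N ⋆ N ≡ (r · (x ⋆ N)) ⊕ (s · x)
  cayley-hamilton {mat a b c d} χ (x₁ , x₂) = cong₂ _,_
    (≡-modulo (≡-modulo (first x₁ x₂ a b c d r s) (sym det≡-s)) trace≡r)
    (≡-modulo (≡-modulo (second x₁ x₂ a b c d r s) (sym det≡-s)) trace≡r)
    where
    open HasCharPolyF χ
    first : ∀ x₁ x₂ a b c d r s → (x₁ * a + x₂ * c) * a + (x₁ * b + x₂ * d) * c
      ≡ (r * (x₁ * a + x₂ * c) + s * x₁ + (x₁ * a + x₂ * c) * ((a + d) - r)) + x₁ * (- s - (a * d - b * c))
    first = solve 8 (λ x₁ x₂ a b c d r s → (x₁ :* a :+ x₂ :* c) :* a :+ (x₁ :* b :+ x₂ :* d) :* c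
      := (r :* (x₁ :* a :+ x₂ :* c) :+ s :* x₁ :+ (x₁ :* a :+ x₂ :* c) :* ((a :+ d) :- r)) :+ x₁ :* (:- s :- (a :* d :- b :* c))) refl
    second : ∀ x₁ x₂ a b c d r s → (x₁ * a + x₂ * c) * b + (x₁ * b + x₂ * d) * d
      ≡ (r * (x₁ * b + x₂ * d) + s * x₂ + (x₁ * b + x₂ * d) * ((a + d) - r)) + x₂ * (- s - (a * d - b * c))
    second = solve 8 (λ x₁ x₂ a b c d r s → (x₁ :* a :+ x₂ :* c) :* b :+ (x₁ :* b :+ x₂ :* d) :* d
      := (r :* (x₁ :* b :+ x₂ :* d) :+ s :* x₂ :+ (x₁ :* b :+ x₂ :* d) :* ((a :+ d) :- r)) :+ x₂ :* (:- s :- (a :* d :- b :* c))) refl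

  𝟎-⋆ : ∀ N → 𝟎 ⋆ N ≡ 𝟎
  𝟎-⋆ (mat a b c d) = cong₂ _,_ (column a c) (column b d)
    where
    column : ∀ p q → 0# * p + 0# * q ≡ 0#
    column = solve 2 (λ p q → :0 :* p :+ :0 :* q := :0) refl

  ⊙-baer : ∀ x m₁ {m₂} → m₂ ≡ 0# → x ⊙ (m₁ , m₂) ≡ m₁ · x
  ⊙-baer x m₁ m₂≡0 = trans (⊙-⋆ x (m₁ , _)) (trans (cong (x ⋆_) (slopeMatrix-baer m₁ m₂≡0)) (⋆-scalarᴹ x m₁))

  𝟎-⊙ : ∀ m → 𝟎 ⊙ m ≡ 𝟎
  𝟎-⊙ m = trans (⊙-⋆ 𝟎 m) (𝟎-⋆ (slopeMatrix m))

  ⊖-self : ∀ x → x ⊖ x ≡ 𝟎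
  ⊖-self (x₁ , x₂) = cong₂ _,_ (identity x₁) (identity x₂)
    where
    identity : ∀ x → x - x ≡ 0#
    identity = solve 1 (λ x → x :- x := :0) refl

  ⊖≡𝟎⇒≡ : ∀ {y z} → y ⊖ z ≡ 𝟎 → y ≡ z
  ⊖≡𝟎⇒≡ {y} {z} y⊖z≡𝟎 = ⊖-cancelʳ z (trans y⊖z≡𝟎 (sym (⊖-self z)))

  e₂ : H
  e₂ = (0# , 1#)

  e₂⊙e₂ : e₂ ⊙ e₂ ≡ (s , r)
  e₂⊙e₂ = begin
    e₂ ⊙ e₂                 ≡⟨ ⊙-⋆ e₂ e₂ ⟩
    e₂ ⋆ slopeMatrix e₂     ≡⟨ cong (e₂ ⋆_) (slopeMatrix-nonBaer 0# (λ 1≡0 → 0≢1 (sym 1≡0))) ⟩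
    e₂ ⋆ companion 0# 1#    ≡⟨ cong₂ _,_ (≡-modulo (first (1# ⁻¹) r s) (⁻¹-inverse 1# (λ 1≡0 → 0≢1 (sym 1≡0)))) (second r) ⟩
    (s , r)                 ∎
    where
    open ≡-Reasoning
    first : ∀ i r s → 0# * 0# + 1# * - (i * (0# * 0# - r * 0# - s)) ≡ s + s * (1# * i - 1#)
    first = solve 3 (λ i r s → :0 :* :0 :+ :1 :* :- (i :* (:0 :* :0 :- r :* :0 :- s))
                            := s :+ s :* (:1 :* i :- :1)) refl
    second : ∀ r → 0# * 1# + 1# * (r - 0#) ≡ r
    second = solve 1 (λ r → :0 :* :1 :+ :1 :* (r :- :0) := r) refl

  ⊕-⊖-cancelˡ : ∀ a x → (a ⊕ x) ⊖ a ≡ x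
  ⊕-⊖-cancelˡ (a₁ , a₂) (x₁ , x₂) = cong₂ _,_ (identity a₁ x₁) (identity a₂ x₂)
    where
    identity : ∀ a x → (a + x) - a ≡ x
    identity = solve 2 (λ a x → (a :+ x) :- a := x) refl

  ⊖-⊕-cancelˡ : ∀ a x → a ⊕ (x ⊖ a) ≡ x
  ⊖-⊕-cancelˡ (a₁ , a₂) (x₁ , x₂) = cong₂ _,_ (identity a₁ x₁) (identity a₂ x₂)
    where
    identity : ∀ a x → a + (x - a) ≡ x
    identity = solve 2 (λ a x → a :+ (x :- a) := x) refl

module Collineations (F : FiniteField) (r s : FiniteField.Carrier F) where
  open FiniteField F
  open Hall F r s
  open FieldArithmetic F
  open Matrices F
  open HallSystem F r s

  data Direction : Set where
    vertical : Direction
    slope    : H → Direction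

  intercept : Direction → Point → H
  intercept vertical  (x , y) = x
  intercept (slope m) (x , y) = y ⊖ x ⊙ m

  lineWith : Direction → H → Line
  lineWith vertical  c = vert c
  lineWith (slope m) k = line m k

  onLine⇒intercept : ∀ d v P → OnLine P (lineWith d v) → intercept d P ≡ v
  onLine⇒intercept vertical  v (x , y) x≡v  = x≡v
  onLine⇒intercept (slope m) v (x , y) refl = ⊕-⊖-cancelˡ (x ⊙ m) v

  intercept⇒onLine : ∀ d v P → intercept d P ≡ v → OnLine P (lineWith d v)
  intercept⇒onLine vertical  v (x , y) x≡v  = x≡v
  intercept⇒onLine (slope m) v (x , y) refl = sym (⊖-⊕-cancelˡ (x ⊙ m) y)

  directionOf : Line → Direction
  directionOf (line m k) = slope m
  directionOf (vert c)   = vertical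

  interceptOf : Line → H
  interceptOf (line m k) = k
  interceptOf (vert c)   = c

  onLine⇒interceptOf : ∀ ℓ P → OnLine P ℓ → intercept (directionOf ℓ) P ≡ interceptOf ℓ
  onLine⇒interceptOf (line m k) = onLine⇒intercept (slope m) k
  onLine⇒interceptOf (vert c)   = onLine⇒intercept vertical c

  O : Point
  O = (𝟎 , 𝟎)

  intercept-O : ∀ d → intercept d O ≡ 𝟎
  intercept-O vertical  = refl
  intercept-O (slope m) = trans (cong (𝟎 ⊖_) (𝟎-⊙ m)) (⊖-self 𝟎)

  intercept-slope-origin : ∀ {m x y} → intercept (slope m) (x , y) ≡ 𝟎 → x ≡ 𝟎 → (x , y) ≡ O
  intercept-slope-origin {m} {x} {y} y⊖xm≡𝟎 refl = cong (𝟎 ,_) (trans (⊖≡𝟎⇒≡ y⊖xm≡𝟎) (𝟎-⊙ m))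

  record Collineation : Set where
    field
      to from           : Point → Point
      to-from           : ∀ P → to (from P) ≡ P
      from-to           : ∀ P → from (to P) ≡ P
      direction         : Direction → Direction
      rescale           : Direction → H → H
      rescale-injective : ∀ d u v → rescale d u ≡ rescale d v → u ≡ v
      intercept-to      : ∀ d P → intercept (direction d) (to P) ≡ rescale d (intercept d P)

    to-injective : ∀ {P Q} → to P ≡ to Q → P ≡ Q
    to-injective {P} {Q} toP≡toQ = trans (sym (from-to P)) (trans (cong from toP≡toQ) (from-to Q))

    mapsLineWith : ∀ d v → MapsLine to (lineWith d v) (lineWith (direction d) (rescale d v))
    mapsLineWith d v Q = mk⇔ preimage image
      where
      preimage : OnLine Q (lineWith (direction d) (rescale d v)) → Σ Point λ P → OnLine P (lineWith d v) × to P ≡ Q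
      preimage Q∈ = from Q , intercept⇒onLine d v (from Q) (rescale-injective d _ _ (begin
        rescale d (intercept d (from Q))       ≡⟨ intercept-to d (from Q) ⟨
        intercept (direction d) (to (from Q))  ≡⟨ cong (intercept (direction d)) (to-from Q) ⟩
        intercept (direction d) Q              ≡⟨ onLine⇒intercept (direction d) _ Q Q∈ ⟩
        rescale d v                            ∎)) , to-from Q
        where open ≡-Reasoning
      image : (Σ Point λ P → OnLine P (lineWith d v) × to P ≡ Q) → OnLine Q (lineWith (direction d) (rescale d v))
      image (P , P∈ , refl) = intercept⇒onLine (direction d) _ (to P)
        (trans (intercept-to d P) (cong (rescale d) (onLine⇒intercept d v P P∈)))

    to-≢-O : ∀ {ℓ P A} → OnLine P ℓ → ¬ OnLine A ℓ → to P ≡ O → ¬ to A ≡ O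
    to-≢-O {ℓ} P∈ℓ A∉ℓ toP≡O toA≡O = A∉ℓ (subst (λ X → OnLine X ℓ) (to-injective (trans toP≡O (sym toA≡O))) P∈ℓ)

    mapsLine : ∀ ℓ → MapsLine to ℓ (lineWith (direction (directionOf ℓ)) (rescale (directionOf ℓ) (interceptOf ℓ)))
    mapsLine (line m k) = mapsLineWith (slope m) k
    mapsLine (vert c)   = mapsLineWith vertical c

    isCollineation : IsCollineation to
    isCollineation = (to-injective , λ Q → from Q , λ { refl → to-from Q }) , λ ℓ → _ , mapsLine ℓ

    rescale-through-origin : ∀ ℓ {P} → OnLine P ℓ → to P ≡ O → rescale (directionOf ℓ) (interceptOf ℓ) ≡ 𝟎
    rescale-through-origin ℓ {P} P∈ toP≡O = begin
      rescale d (interceptOf ℓ)        ≡⟨ cong (rescale d) (onLine⇒interceptOf ℓ P P∈) ⟨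
      rescale d (intercept d P)        ≡⟨ intercept-to d P ⟨
      intercept (direction d) (to P)   ≡⟨ cong (intercept (direction d)) toP≡O ⟩
      intercept (direction d) O        ≡⟨ intercept-O (direction d) ⟩
      𝟎                                ∎
      where
      open ≡-Reasoning
      d : Direction
      d = directionOf ℓ

    mapsLine-origin : ∀ ℓ {P d'} → OnLine P ℓ → to P ≡ O → direction (directionOf ℓ) ≡ d' → MapsLine to ℓ (lineWith d' 𝟎)
    mapsLine-origin ℓ P∈ toP≡O refl =
      subst (λ w → MapsLine to ℓ (lineWith (direction (directionOf ℓ)) w)) (rescale-through-origin ℓ P∈ toP≡O) (mapsLine ℓ)

    intercept-image : ∀ ℓ {P A} → OnLine P ℓ → OnLine A ℓ → to P ≡ O → intercept (direction (directionOf ℓ)) (to A) ≡ 𝟎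
    intercept-image ℓ {A = A} P∈ A∈ toP≡O = trans (intercept-to (directionOf ℓ) A)
      (trans (cong (rescale (directionOf ℓ)) (onLine⇒interceptOf ℓ A A∈)) (rescale-through-origin ℓ P∈ toP≡O))

  infixr 9 _∘ᶜ_
  _∘ᶜ_ : Collineation → Collineation → Collineation
  C₂ ∘ᶜ C₁ = record
    { to                = λ P → C₂.to (C₁.to P)
    ; from              = λ P → C₁.from (C₂.from P)
    ; to-from           = λ P → trans (cong C₂.to (C₁.to-from (C₂.from P))) (C₂.to-from P)
    ; from-to           = λ P → trans (cong C₁.from (C₂.from-to (C₁.to P))) (C₁.from-to P)
    ; direction         = λ d → C₂.direction (C₁.direction d)
    ; rescale           = λ d v → C₂.rescale (C₁.direction d) (C₁.rescale d v)
    ; rescale-injective = λ d u v eq → C₁.rescale-injective d u v (C₂.rescale-injective (C₁.direction d) _ _ eq)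
    ; intercept-to      = λ d P → trans (C₂.intercept-to (C₁.direction d) (C₁.to P))
                                        (cong (C₂.rescale (C₁.direction d)) (C₁.intercept-to d P))
    }
    where
    module C₁ = Collineation C₁
    module C₂ = Collineation C₂

  idᶜ : Collineation
  idᶜ = record
    { to = λ P → P ; from = λ P → P ; to-from = λ _ → refl ; from-to = λ _ → refl
    ; direction = λ d → d ; rescale = λ _ v → v ; rescale-injective = λ _ _ _ eq → eq
    ; intercept-to = λ _ _ → refl }

  translation : Point → Collineation
  translation A@(a , b) = record
    { to                = λ { (x , y) → (x ⊖ a , y ⊖ b) }
    ; from              = λ { (x , y) → (a ⊕ x , b ⊕ y) }
    ; to-from           = λ { (x , y) → cong₂ _,_ (⊕-⊖-cancelˡ a x) (⊕-⊖-cancelˡ b y) }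
    ; from-to           = λ { (x , y) → cong₂ _,_ (⊖-⊕-cancelˡ a x) (⊖-⊕-cancelˡ b y) }
    ; direction         = λ d → d
    ; rescale           = λ d v → v ⊖ intercept d A
    ; rescale-injective = λ d u v → ⊖-cancelʳ (intercept d A)
    ; intercept-to      = intercept-difference
    }
    where
    intercept-difference : ∀ d P → intercept d (proj₁ P ⊖ a , proj₂ P ⊖ b) ≡ intercept d P ⊖ intercept d A
    intercept-difference vertical  (x , y) = refl
    intercept-difference (slope m) (x , y) = begin
      (y ⊖ b) ⊖ (x ⊖ a) ⊙ m                 ≡⟨ cong ((y ⊖ b) ⊖_) (trans (⊙-⋆ (x ⊖ a) m) (⊖-⋆ x a (slopeMatrix m))) ⟩
      (y ⊖ b) ⊖ (x ⋆ slopeMatrix m ⊖ a ⋆ slopeMatrix m)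
                                            ≡⟨ ⊖-interchange y b _ _ ⟩
      (y ⊖ x ⋆ slopeMatrix m) ⊖ (b ⊖ a ⋆ slopeMatrix m)
                                            ≡⟨ cong₂ (λ u v → (y ⊖ u) ⊖ (b ⊖ v)) (⊙-⋆ x m) (⊙-⋆ a m) ⟨
      (y ⊖ x ⊙ m) ⊖ (b ⊖ a ⊙ m)             ∎
      where open ≡-Reasoning

  translation-to-self : ∀ A → Collineation.to (translation A) A ≡ O
  translation-to-self (a , b) = cong₂ _,_ (⊖-self a) (⊖-self b)

  pairwise : Matrix → Point → Point
  pairwise L ((x₁ , x₂) , (y₁ , y₂)) = ((proj₁ u₁ , proj₁ u₂) , (proj₂ u₁ , proj₂ u₂))
    where
    u₁ u₂ : Vector
    u₁ = (x₁ , y₁) ⋆ L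
    u₂ = (x₂ , y₂) ⋆ L

  pairwise-inverse : ∀ {A B} → A *ᴹ B ≡ 1ᴹ → ∀ P → pairwise B (pairwise A P) ≡ P
  pairwise-inverse {A} {B} AB≡1 ((x₁ , x₂) , (y₁ , y₂)) =
    cong₂ _,_ (cong₂ _,_ (cong proj₁ eq₁) (cong proj₁ eq₂)) (cong₂ _,_ (cong proj₂ eq₁) (cong proj₂ eq₂))
    where
    eq₁ : (x₁ , y₁) ⋆ A ⋆ B ≡ (x₁ , y₁)
    eq₁ = ⋆-inverse AB≡1 (x₁ , y₁)
    eq₂ : (x₂ , y₂) ⋆ A ⋆ B ≡ (x₂ , y₂)
    eq₂ = ⋆-inverse AB≡1 (x₂ , y₂)

  pairwise-O : ∀ L → pairwise L O ≡ O
  pairwise-O L = cong₂ _,_ (cong₂ _,_ (cong proj₁ (𝟎-⋆ L)) (cong proj₁ (𝟎-⋆ L))) (cong₂ _,_ (cong proj₂ (𝟎-⋆ L)) (cong proj₂ (𝟎-⋆ L)))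

  -- If N has characteristic polynomial f then (N − c) N = s + (r − c) N, so lines of slope N
  -- keep their slope under mix, while the slope c I becomes vertical.
  module Mixing (c : Carrier) (fc≢0 : ¬ fpoly c ≡ 0#) where

    mixingMatrix : Matrix
    mixingMatrix = mat (- c) s 1# (r - c)

    det-mixingMatrix : det mixingMatrix ≡ fpoly c
    det-mixingMatrix = identity c r s
      where
      identity : ∀ c r s → - c * (r - c) - s * 1# ≡ c * c - r * c - s
      identity = solve 3 (λ c r s → :- c :* (r :- c) :- s :* :1 := c :* c :- r :* c :- s) refl

    mixingMatrix-det-nonzero : ¬ det mixingMatrix ≡ 0#
    mixingMatrix-det-nonzero det≡0 = fc≢0 (trans (sym det-mixingMatrix) det≡0)

    slopeAction : (d e : Carrier) → Dec (e ≡ 0#) → Dec (d - c ≡ 0#) → Direction × Matrix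
    slopeAction d e (yes _) (yes _) = vertical , 1ᴹ
    slopeAction d e (yes _) (no _)  = slope ((s + (r - c) * d) * (d - c) ⁻¹ , 0#) , scalarᴹ (fpoly c * (d - c) ⁻¹)
    slopeAction d e (no _)  _       = slope (d , e) , scalarᴹ (r - c) -ᴹ companion d e

    action : Direction → Direction × Matrix
    action vertical        = slope (r - c , 0#) , scalarᴹ (- fpoly c)
    action (slope (d , e)) = slopeAction d e (e ≟ 0#) ((d - c) ≟ 0#)

    direction : Direction → Direction
    direction d = proj₁ (action d)

    rescaleMatrix : Direction → Matrix
    rescaleMatrix d = proj₂ (action d)

    slopeAction-det-nonzero : ∀ d e de dc → ¬ det (proj₂ (slopeAction d e de dc)) ≡ 0#
    slopeAction-det-nonzero d e (yes _) (yes _)      = scalarᴹ-det-nonzero (λ 1≡0 → 0≢1 (sym 1≡0))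
    slopeAction-det-nonzero d e (yes _) (no d-c≢0)   = scalarᴹ-det-nonzero (*-nonzero fc≢0 (⁻¹-nonzero d-c≢0))
    slopeAction-det-nonzero d e (no e≢0) _ det≡0 = fc≢0 (begin
      fpoly c                                       ≡⟨ identity c r s ⟩
      (r - c) * (r - c) - r * (r - c) + - s         ≡⟨ cong₂ (λ t δ → (r - c) * (r - c) - t * (r - c) + δ) trace≡r det≡-s ⟨
      (r - c) * (r - c) - trace N * (r - c) + det N ≡⟨ det-characteristic (r - c) N ⟨
      det (scalarᴹ (r - c) -ᴹ N)                    ≡⟨ det≡0 ⟩
      0#                                            ∎)
      where
      open ≡-Reasoning
      N : Matrix
      N = companion d e
      open HasCharPolyF (companion-hasCharPolyF d e≢0)
      identity : ∀ c r s → c * c - r * c - s ≡ (r - c) * (r - c) - r * (r - c) + - s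
      identity = solve 3 (λ c r s → c :* c :- r :* c :- s := (r :- c) :* (r :- c) :- r :* (r :- c) :+ :- s) refl

    rescaleMatrix-det-nonzero : ∀ d → ¬ det (rescaleMatrix d) ≡ 0#
    rescaleMatrix-det-nonzero vertical        = scalarᴹ-det-nonzero (-‿nonzero fc≢0)
    rescaleMatrix-det-nonzero (slope (d , e)) = slopeAction-det-nonzero d e (e ≟ 0#) ((d - c) ≟ 0#)

    mix : Point → Point
    mix = pairwise mixingMatrix

    intercept-mix-nonBaer : ∀ {N} → HasCharPolyF N → ∀ P →
      proj₂ (mix P) ⊖ proj₁ (mix P) ⋆ N ≡ (proj₂ P ⊖ proj₁ P ⋆ N) ⋆ (scalarᴹ (r - c) -ᴹ N)
    intercept-mix-nonBaer {mat a b c' d'} χ ((x₁ , x₂) , (y₁ , y₂)) = cong₂ _,_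
      (≡-modulo (first x₁ x₂ y₁ y₂ a b c' d' c r s) (cong proj₁ (cayley-hamilton χ (x₁ , x₂))))
      (≡-modulo (second x₁ x₂ y₁ y₂ a b c' d' c r s) (cong proj₂ (cayley-hamilton χ (x₁ , x₂))))
      where
      first : ∀ x₁ x₂ y₁ y₂ a b c' d' c r s →
        (x₁ * s + y₁ * (r - c)) - ((x₁ * - c + y₁ * 1#) * a + (x₂ * - c + y₂ * 1#) * c')
        ≡ ((y₁ - (x₁ * a + x₂ * c')) * ((r - c) - a) + (y₂ - (x₁ * b + x₂ * d')) * (0# - c'))
          + (- 1#) * (((x₁ * a + x₂ * c') * a + (x₁ * b + x₂ * d') * c') - (r * (x₁ * a + x₂ * c') + s * x₁))
      first = solve 11 (λ x₁ x₂ y₁ y₂ a b c' d' c r s →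
        (x₁ :* s :+ y₁ :* (r :- c)) :- ((x₁ :* :- c :+ y₁ :* :1) :* a :+ (x₂ :* :- c :+ y₂ :* :1) :* c')
        := ((y₁ :- (x₁ :* a :+ x₂ :* c')) :* ((r :- c) :- a) :+ (y₂ :- (x₁ :* b :+ x₂ :* d')) :* (:0 :- c'))
           :+ (:- :1) :* (((x₁ :* a :+ x₂ :* c') :* a :+ (x₁ :* b :+ x₂ :* d') :* c') :- (r :* (x₁ :* a :+ x₂ :* c') :+ s :* x₁))) refl
      second : ∀ x₁ x₂ y₁ y₂ a b c' d' c r s →
        (x₂ * s + y₂ * (r - c)) - ((x₁ * - c + y₁ * 1#) * b + (x₂ * - c + y₂ * 1#) * d')
        ≡ ((y₁ - (x₁ * a + x₂ * c')) * (0# - b) + (y₂ - (x₁ * b + x₂ * d')) * ((r - c) - d'))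
          + (- 1#) * (((x₁ * a + x₂ * c') * b + (x₁ * b + x₂ * d') * d') - (r * (x₁ * b + x₂ * d') + s * x₂))
      second = solve 11 (λ x₁ x₂ y₁ y₂ a b c' d' c r s →
        (x₂ :* s :+ y₂ :* (r :- c)) :- ((x₁ :* :- c :+ y₁ :* :1) :* b :+ (x₂ :* :- c :+ y₂ :* :1) :* d')
        := ((y₁ :- (x₁ :* a :+ x₂ :* c')) :* (:0 :- b) :+ (y₂ :- (x₁ :* b :+ x₂ :* d')) :* ((r :- c) :- d'))
           :+ (:- :1) :* (((x₁ :* a :+ x₂ :* c') :* b :+ (x₁ :* b :+ x₂ :* d') :* d') :- (r :* (x₁ :* b :+ x₂ :* d') :+ s :* x₂))) refl

    intercept-mix-slope : ∀ d e de dc P → intercept (proj₁ (slopeAction d e de dc)) (mix P)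
                                       ≡ intercept (slope (d , e)) P ⋆ proj₂ (slopeAction d e de dc)
    intercept-mix-slope d e (yes e≡0) (yes d-c≡0) P@((x₁ , x₂) , (y₁ , y₂)) = begin
      proj₁ (mix P)                 ≡⟨ cong₂ _,_ (≡-modulo (identity x₁ y₁ c d) d-c≡0) (≡-modulo (identity x₂ y₂ c d) d-c≡0) ⟩
      (y₁ , y₂) ⊖ d · (x₁ , x₂)     ≡⟨ cong ((y₁ , y₂) ⊖_) (⊙-baer (x₁ , x₂) d e≡0) ⟨
      (y₁ , y₂) ⊖ (x₁ , x₂) ⊙ (d , e)  ≡⟨ ⋆-identityʳ _ ⟨
      ((y₁ , y₂) ⊖ (x₁ , x₂) ⊙ (d , e)) ⋆ 1ᴹ ∎
      where
      open ≡-Reasoning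
      identity : ∀ x y c d → x * - c + y * 1# ≡ (y - d * x) + x * ((d - c) - 0#)
      identity = solve 4 (λ x y c d → x :* :- c :+ y :* :1 := (y :- d :* x) :+ x :* ((d :- c) :- :0)) refl
    intercept-mix-slope d e (yes e≡0) (no d-c≢0) P@((x₁ , x₂) , (y₁ , y₂)) = begin
      proj₂ (mix P) ⊖ proj₁ (mix P) ⊙ (k , 0#)     ≡⟨ cong (proj₂ (mix P) ⊖_) (⊙-baer (proj₁ (mix P)) k refl) ⟩
      proj₂ (mix P) ⊖ k · proj₁ (mix P)            ≡⟨ cong₂ _,_ (≡-modulo (identity x₁ y₁ c d ((d - c) ⁻¹) r s) d-c-inverse)
                                                                  (≡-modulo (identity x₂ y₂ c d ((d - c) ⁻¹) r s) d-c-inverse) ⟩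
      (fpoly c * (d - c) ⁻¹) · ((y₁ , y₂) ⊖ d · (x₁ , x₂))
                                                   ≡⟨ cong (λ u → (fpoly c * (d - c) ⁻¹) · ((y₁ , y₂) ⊖ u)) (⊙-baer (x₁ , x₂) d e≡0) ⟨
      (fpoly c * (d - c) ⁻¹) · ((y₁ , y₂) ⊖ (x₁ , x₂) ⊙ (d , e))
                                                   ≡⟨ ⋆-scalarᴹ _ _ ⟨
      ((y₁ , y₂) ⊖ (x₁ , x₂) ⊙ (d , e)) ⋆ scalarᴹ (fpoly c * (d - c) ⁻¹) ∎
      where
      open ≡-Reasoning
      k : Carrier
      k = (s + (r - c) * d) * (d - c) ⁻¹
      d-c-inverse : 1# ≡ (d - c) * (d - c) ⁻¹
      d-c-inverse = sym (⁻¹-inverse (d - c) d-c≢0)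
      identity : ∀ x y c d i r s → (x * s + y * (r - c)) - ((s + (r - c) * d) * i) * (x * - c + y * 1#)
                 ≡ ((c * c - r * c - s) * i) * (y - d * x) + (x * s + y * (r - c)) * (1# - (d - c) * i)
      identity = solve 7 (λ x y c d i r s → (x :* s :+ y :* (r :- c)) :- ((s :+ (r :- c) :* d) :* i) :* (x :* :- c :+ y :* :1)
                 := ((c :* c :- r :* c :- s) :* i) :* (y :- d :* x) :+ (x :* s :+ y :* (r :- c)) :* (:1 :- (d :- c) :* i)) refl
    intercept-mix-slope d e (no e≢0) _ P@((x₁ , x₂) , (y₁ , y₂)) = begin
      proj₂ (mix P) ⊖ proj₁ (mix P) ⊙ (d , e)      ≡⟨ cong (proj₂ (mix P) ⊖_) (⊙-companion (proj₁ (mix P))) ⟩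
      proj₂ (mix P) ⊖ proj₁ (mix P) ⋆ N            ≡⟨ intercept-mix-nonBaer (companion-hasCharPolyF d e≢0) P ⟩
      ((y₁ , y₂) ⊖ (x₁ , x₂) ⋆ N) ⋆ (scalarᴹ (r - c) -ᴹ N)
                                                   ≡⟨ cong (λ u → ((y₁ , y₂) ⊖ u) ⋆ (scalarᴹ (r - c) -ᴹ N)) (⊙-companion (x₁ , x₂)) ⟨
      ((y₁ , y₂) ⊖ (x₁ , x₂) ⊙ (d , e)) ⋆ (scalarᴹ (r - c) -ᴹ N) ∎
      where
      open ≡-Reasoning
      N : Matrix
      N = companion d e
      ⊙-companion : ∀ x → x ⊙ (d , e) ≡ x ⋆ N
      ⊙-companion x = trans (⊙-⋆ x (d , e)) (cong (x ⋆_) (slopeMatrix-nonBaer d e≢0))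

    intercept-mix : ∀ d P → intercept (direction d) (mix P) ≡ intercept d P ⋆ rescaleMatrix d
    intercept-mix vertical P@((x₁ , x₂) , (y₁ , y₂)) = begin
      proj₂ (mix P) ⊖ proj₁ (mix P) ⊙ (r - c , 0#)       ≡⟨ cong (proj₂ (mix P) ⊖_) (⊙-baer (proj₁ (mix P)) (r - c) refl) ⟩
      proj₂ (mix P) ⊖ (r - c) · proj₁ (mix P)            ≡⟨ cong₂ _,_ (identity x₁ y₁ c r s) (identity x₂ y₂ c r s) ⟩
      (- fpoly c) · (x₁ , x₂)                            ≡⟨ ⋆-scalarᴹ (x₁ , x₂) (- fpoly c) ⟨
      (x₁ , x₂) ⋆ scalarᴹ (- fpoly c)                    ∎
      where
      open ≡-Reasoning
      identity : ∀ x y c r s → (x * s + y * (r - c)) - (r - c) * (x * - c + y * 1#) ≡ (- (c * c - r * c - s)) * x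
      identity = solve 5 (λ x y c r s → (x :* s :+ y :* (r :- c)) :- (r :- c) :* (x :* :- c :+ y :* :1)
                                      := (:- (c :* c :- r :* c :- s)) :* x) refl
    intercept-mix (slope (d , e)) P = intercept-mix-slope d e (e ≟ 0#) ((d - c) ≟ 0#) P

    collineation : Collineation
    collineation = record
      { to                = mix
      ; from              = pairwise (mixingMatrix ⁻¹ᴹ)
      ; to-from           = pairwise-inverse (*ᴹ-inverseˡ mixingMatrix mixingMatrix-det-nonzero)
      ; from-to           = pairwise-inverse (*ᴹ-inverseʳ mixingMatrix mixingMatrix-det-nonzero)
      ; direction         = direction
      ; rescale           = λ d v → v ⋆ rescaleMatrix d
      ; rescale-injective = λ d → ⋆-injective (rescaleMatrix d) (rescaleMatrix-det-nonzero d)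
      ; intercept-to      = intercept-mix
      }

    direction-baer-c : ∀ {e} → e ≡ 0# → direction (slope (c , e)) ≡ vertical
    direction-baer-c {e} e≡0 = slopeAction-c (e ≟ 0#) ((c - c) ≟ 0#)
      where
      c-c≡0 : ∀ c → c - c ≡ 0#
      c-c≡0 = solve 1 (λ c → c :- c := :0) refl
      slopeAction-c : ∀ de dc → proj₁ (slopeAction c e de dc) ≡ vertical
      slopeAction-c (yes _)  (yes _)    = refl
      slopeAction-c (yes _)  (no c-c≢0) = contradiction (c-c≡0 c) c-c≢0
      slopeAction-c (no e≢0) _          = contradiction e≡0 e≢0

    direction-nonBaer : ∀ {d e} → ¬ e ≡ 0# → direction (slope (d , e)) ≡ slope (d , e)
    direction-nonBaer {d} {e} e≢0 = slopeAction-nonBaer (e ≟ 0#) ((d - c) ≟ 0#)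
      where
      slopeAction-nonBaer : ∀ de dc → proj₁ (slopeAction d e de dc) ≡ slope (d , e)
      slopeAction-nonBaer (yes e≡0) _ = contradiction e≡0 e≢0
      slopeAction-nonBaer (no _)    _ = refl

module HallCollineations (F : FiniteField) (r s : FiniteField.Carrier F) (irreducible : Hall.Irreducible F r s) where
  open FiniteField F
  open Hall F r s
  open FieldArithmetic F
  open Matrices F
  open HallSystem F r s
  open Collineations F r s
  open ≡-Reasoning

  fpoly-nonzero : ∀ x → ¬ fpoly x ≡ 0#
  fpoly-nonzero x fx≡0 = irreducible (x , r - x , add-sub x r , ≡-modulo (product x r s) fx≡0)
    where
    add-sub : ∀ x r → x + (r - x) ≡ r
    add-sub = solve 2 (λ x r → x :+ (r :- x) := r) refl
    product : ∀ x r s → x * (r - x) ≡ - s + (- 1#) * ((x * x - r * x - s) - 0#)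
    product = solve 3 (λ x r s → x :* (r :- x) := :- s :+ (:- :1) :* ((x :* x :- r :* x :- s) :- :0)) refl

  s-nonzero : ¬ s ≡ 0#
  s-nonzero s≡0 = fpoly-nonzero 0# (≡-modulo (f-at-0 r s) s≡0)
    where
    f-at-0 : ∀ r s → 0# * 0# - r * 0# - s ≡ 0# + (- 1#) * (s - 0#)
    f-at-0 = solve 2 (λ r s → :0 :* :0 :- r :* :0 :- s := :0 :+ (:- :1) :* (s :- :0)) refl

  hasCharPolyF⇒m₁₂≢0 : ∀ {N} → HasCharPolyF N → ¬ Matrix.m₁₂ N ≡ 0#
  hasCharPolyF⇒m₁₂≢0 {mat a b c d} χ b≡0 = irreducible (a , d , trace≡r , trans (≡-modulo (product a b c d) b≡0) det≡-s)
    where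
    open HasCharPolyF χ
    product : ∀ a b c d → a * d ≡ (a * d - b * c) + c * (b - 0#)
    product = solve 4 (λ a b c d → a :* d := (a :* d :- b :* c) :+ c :* (b :- :0)) refl

  anisotropic : ∀ X Y → ¬ Y ≡ 0# → ¬ X * X - r * X * Y - s * Y * Y ≡ 0#
  anisotropic X Y Y≢0 form≡0 = fpoly-nonzero (X * Y ⁻¹) (begin
    fpoly (X * Y ⁻¹)                              ≡⟨ ≡-modulo (expand X Y (Y ⁻¹) r s) (sym (⁻¹-inverse Y Y≢0)) ⟩
    (X * X - r * X * Y - s * Y * Y) * (Y ⁻¹ * Y ⁻¹) ≡⟨ cong (_* (Y ⁻¹ * Y ⁻¹)) form≡0 ⟩
    0# * (Y ⁻¹ * Y ⁻¹)                            ≡⟨ zeroˡ _ ⟩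
    0#                                            ∎)
    where
    expand : ∀ X Y i r s → (X * i) * (X * i) - r * (X * i) - s
             ≡ (X * X - r * X * Y - s * Y * Y) * (i * i) + (- (r * X * i) - s * (1# + Y * i)) * (1# - Y * i)
    expand = solve 5 (λ X Y i r s → (X :* i) :* (X :* i) :- r :* (X :* i) :- s
             := (X :* X :- r :* X :* Y :- s :* Y :* Y) :* (i :* i) :+ (:- (r :* X :* i) :- s :* (:1 :+ Y :* i)) :* (:1 :- Y :* i)) refl
    zeroˡ : ∀ x → 0# * x ≡ 0#
    zeroˡ = solve 1 (λ x → :0 :* x := :0) refl

  nonzero-component : ∀ {a₁ a₂} → ¬ (a₁ , a₂) ≡ 𝟎 → ¬ a₁ ≡ 0# ⊎ ¬ a₂ ≡ 0#
  nonzero-component {a₁} {a₂} a≢𝟎 with a₁ ≟ 0# | a₂ ≟ 0#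
  ... | no a₁≢0  | _         = inj₁ a₁≢0
  ... | yes _    | no a₂≢0   = inj₂ a₂≢0
  ... | yes a₁≡0 | yes a₂≡0  = contradiction (cong₂ _,_ a₁≡0 a₂≡0) a≢𝟎

  no-eigenvector : ∀ {N} → HasCharPolyF N → ∀ {a} → ¬ a ≡ 𝟎 → ¬ det (fromRows (a ⋆ N) a) ≡ 0#
  no-eigenvector {N@(mat n₁ n₂ n₃ n₄)} χ {a@(a₁ , a₂)} a≢𝟎 det≡0 with nonzero-component a≢𝟎
  ... | inj₁ a₁≢0 = anisotropic _ a₁ a₁≢0
    (≡-modulo (≡-modulo (first a₁ a₂ n₁ n₂ n₃ n₄ r s) (cong proj₁ (cayley-hamilton χ a))) det≡0)
    where
    first : ∀ a₁ a₂ n₁ n₂ n₃ n₄ r s →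
      (a₁ * n₁ + a₂ * n₃) * (a₁ * n₁ + a₂ * n₃) - r * (a₁ * n₁ + a₂ * n₃) * a₁ - s * a₁ * a₁
      ≡ (0# + n₃ * (((a₁ * n₁ + a₂ * n₃) * a₂ - (a₁ * n₂ + a₂ * n₄) * a₁) - 0#))
        + a₁ * (((a₁ * n₁ + a₂ * n₃) * n₁ + (a₁ * n₂ + a₂ * n₄) * n₃) - (r * (a₁ * n₁ + a₂ * n₃) + s * a₁))
    first = solve 8 (λ a₁ a₂ n₁ n₂ n₃ n₄ r s →
      (a₁ :* n₁ :+ a₂ :* n₃) :* (a₁ :* n₁ :+ a₂ :* n₃) :- r :* (a₁ :* n₁ :+ a₂ :* n₃) :* a₁ :- s :* a₁ :* a₁
      := (:0 :+ n₃ :* (((a₁ :* n₁ :+ a₂ :* n₃) :* a₂ :- (a₁ :* n₂ :+ a₂ :* n₄) :* a₁) :- :0))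
         :+ a₁ :* (((a₁ :* n₁ :+ a₂ :* n₃) :* n₁ :+ (a₁ :* n₂ :+ a₂ :* n₄) :* n₃) :- (r :* (a₁ :* n₁ :+ a₂ :* n₃) :+ s :* a₁))) refl
  ... | inj₂ a₂≢0 = anisotropic _ a₂ a₂≢0
    (≡-modulo (≡-modulo (second a₁ a₂ n₁ n₂ n₃ n₄ r s) (cong proj₂ (cayley-hamilton χ a))) det≡0)
    where
    second : ∀ a₁ a₂ n₁ n₂ n₃ n₄ r s →
      (a₁ * n₂ + a₂ * n₄) * (a₁ * n₂ + a₂ * n₄) - r * (a₁ * n₂ + a₂ * n₄) * a₂ - s * a₂ * a₂
      ≡ (0# + (- n₂) * (((a₁ * n₁ + a₂ * n₃) * a₂ - (a₁ * n₂ + a₂ * n₄) * a₁) - 0#))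
        + a₂ * (((a₁ * n₁ + a₂ * n₃) * n₂ + (a₁ * n₂ + a₂ * n₄) * n₄) - (r * (a₁ * n₂ + a₂ * n₄) + s * a₂))
    second = solve 8 (λ a₁ a₂ n₁ n₂ n₃ n₄ r s →
      (a₁ :* n₂ :+ a₂ :* n₄) :* (a₁ :* n₂ :+ a₂ :* n₄) :- r :* (a₁ :* n₂ :+ a₂ :* n₄) :* a₂ :- s :* a₂ :* a₂
      := (:0 :+ (:- n₂) :* (((a₁ :* n₁ :+ a₂ :* n₃) :* a₂ :- (a₁ :* n₂ :+ a₂ :* n₄) :* a₁) :- :0))
         :+ a₂ :* (((a₁ :* n₁ :+ a₂ :* n₃) :* n₂ :+ (a₁ :* n₂ :+ a₂ :* n₄) :* n₄) :- (r :* (a₁ :* n₂ :+ a₂ :* n₄) :+ s :* a₂))) refl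

  module Conjugation (P Q : Matrix) (PQ≡1 : P *ᴹ Q ≡ 1ᴹ) (QP≡1 : Q *ᴹ P ≡ 1ᴹ) where

    conjugate : Matrix → Matrix
    conjugate N = Q *ᴹ N *ᴹ P

    conjugate-hasCharPolyF : ∀ {N} → HasCharPolyF N → HasCharPolyF (conjugate N)
    conjugate-hasCharPolyF {N} χ = record
      { trace≡r = trans (trace-conjugate PQ≡1 N) trace≡r
      ; det≡-s  = trans (det-conjugate PQ≡1 N) det≡-s }
      where open HasCharPolyF χ

    ⋆-conjugate : ∀ x N → x ⋆ P ⋆ conjugate N ≡ x ⋆ N ⋆ P
    ⋆-conjugate x N = begin
      x ⋆ P ⋆ (Q *ᴹ N *ᴹ P)  ≡⟨ ⋆-assoc (x ⋆ P) (Q *ᴹ N) P ⟨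
      x ⋆ P ⋆ (Q *ᴹ N) ⋆ P   ≡⟨ cong (_⋆ P) (⋆-assoc (x ⋆ P) Q N) ⟨
      x ⋆ P ⋆ Q ⋆ N ⋆ P      ≡⟨ cong (λ z → z ⋆ N ⋆ P) (⋆-inverse PQ≡1 x) ⟩
      x ⋆ N ⋆ P              ∎

    slopeImage : (d e : Carrier) → Dec (e ≡ 0#) → H
    slopeImage d e (yes _) = (d , e)
    slopeImage d e (no _)  = row₁ (conjugate (companion d e))

    direction : Direction → Direction
    direction vertical        = vertical
    direction (slope (d , e)) = slope (slopeImage d e (e ≟ 0#))

    slopeImage-⊙ : ∀ d e de x → (x ⋆ P) ⊙ slopeImage d e de ≡ (x ⊙ (d , e)) ⋆ P
    slopeImage-⊙ d e (yes e≡0) x = begin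
      (x ⋆ P) ⊙ (d , e)       ≡⟨ ⊙-baer (x ⋆ P) d e≡0 ⟩
      d · (x ⋆ P)           ≡⟨ ·-⋆ d x P ⟨
      (d · x) ⋆ P           ≡⟨ cong (_⋆ P) (⊙-baer x d e≡0) ⟨
      (x ⊙ (d , e)) ⋆ P     ∎
    slopeImage-⊙ d e (no e≢0) x = begin
      (x ⋆ P) ⊙ row₁ (conjugate N)            ≡⟨ ⊙-⋆ (x ⋆ P) _ ⟩
      x ⋆ P ⋆ slopeMatrix (row₁ (conjugate N)) ≡⟨ cong (x ⋆ P ⋆_) (slopeMatrix-row₁ (conjugate N) (hasCharPolyF⇒m₁₂≢0 χ′) χ′) ⟩
      x ⋆ P ⋆ conjugate N                   ≡⟨ ⋆-conjugate x N ⟩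
      x ⋆ N ⋆ P                             ≡⟨ cong (λ z → x ⋆ z ⋆ P) (slopeMatrix-nonBaer d e≢0) ⟨
      x ⋆ slopeMatrix (d , e) ⋆ P           ≡⟨ cong (_⋆ P) (⊙-⋆ x (d , e)) ⟨
      (x ⊙ (d , e)) ⋆ P                     ∎
      where
      N : Matrix
      N = companion d e
      χ′ : HasCharPolyF (conjugate N)
      χ′ = conjugate-hasCharPolyF (companion-hasCharPolyF d e≢0)

    conj : Point → Point
    conj (x , y) = (x ⋆ P , y ⋆ P)

    intercept-conj : ∀ d X → intercept (direction d) (conj X) ≡ intercept d X ⋆ P
    intercept-conj vertical        (x , y) = refl
    intercept-conj (slope (d , e)) (x , y) = begin
      y ⋆ P ⊖ (x ⋆ P) ⊙ slopeImage d e (e ≟ 0#) ≡⟨ cong (y ⋆ P ⊖_) (slopeImage-⊙ d e (e ≟ 0#) x) ⟩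
      y ⋆ P ⊖ (x ⊙ (d , e)) ⋆ P               ≡⟨ ⊖-⋆ y (x ⊙ (d , e)) P ⟨
      (y ⊖ x ⊙ (d , e)) ⋆ P                   ∎

    collineation : Collineation
    collineation = record
      { to                = conj
      ; from              = λ { (x , y) → (x ⋆ Q , y ⋆ Q) }
      ; to-from           = λ { (x , y) → cong₂ _,_ (⋆-inverse QP≡1 x) (⋆-inverse QP≡1 y) }
      ; from-to           = λ { (x , y) → cong₂ _,_ (⋆-inverse PQ≡1 x) (⋆-inverse PQ≡1 y) }
      ; direction         = direction
      ; rescale           = λ _ v → v ⋆ P
      ; rescale-injective = λ _ → ⋆-cancelʳ PQ≡1
      ; intercept-to      = intercept-conj
      }

    conj-O : conj O ≡ O
    conj-O = cong₂ _,_ (𝟎-⋆ P) (𝟎-⋆ P)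

  -- Q has rows u and a with u N = a and a N = r a + s u, so Q N Q⁻¹ has first row (0 , 1).
  module Normalisation (m₁ m₂ : Carrier) (m₂≢0 : ¬ m₂ ≡ 0#) (a : H) (a≢𝟎 : ¬ a ≡ 𝟎) where

    N : Matrix
    N = companion m₁ m₂

    χ : HasCharPolyF N
    χ = companion-hasCharPolyF m₁ m₂≢0

    u : H
    u = s ⁻¹ · (a ⋆ N ⊖ r · a)

    Q : Matrix
    Q = fromRows u a

    det-Q≢0 : ¬ det Q ≡ 0#
    det-Q≢0 det≡0 = no-eigenvector χ a≢𝟎 (nonzero-*-zero (⁻¹-nonzero s-nonzero)
      (trans (sym (identity (proj₁ a) (proj₂ a) (proj₁ (a ⋆ N)) (proj₂ (a ⋆ N)) r (s ⁻¹))) det≡0))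
      where
      identity : ∀ a₁ a₂ p q r i → (i * (p - r * a₁)) * a₂ - (i * (q - r * a₂)) * a₁ ≡ i * (p * a₂ - q * a₁)
      identity = solve 6 (λ a₁ a₂ p q r i → (i :* (p :- r :* a₁)) :* a₂ :- (i :* (q :- r :* a₂)) :* a₁
                                          := i :* (p :* a₂ :- q :* a₁)) refl

    P : Matrix
    P = Q ⁻¹ᴹ

    open Conjugation P Q (*ᴹ-inverseˡ Q det-Q≢0) (*ᴹ-inverseʳ Q det-Q≢0) public

    u⋆N≡a : u ⋆ N ≡ a
    u⋆N≡a = begin
      (s ⁻¹ · (a ⋆ N ⊖ r · a)) ⋆ N          ≡⟨ ·-⋆ (s ⁻¹) _ N ⟩
      s ⁻¹ · ((a ⋆ N ⊖ r · a) ⋆ N)          ≡⟨ cong (s ⁻¹ ·_) (⊖-⋆ (a ⋆ N) (r · a) N) ⟩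
      s ⁻¹ · (a ⋆ N ⋆ N ⊖ (r · a) ⋆ N)      ≡⟨ cong₂ (λ p q → s ⁻¹ · (p ⊖ q)) (cayley-hamilton χ a) (·-⋆ r a N) ⟩
      s ⁻¹ · ((r · (a ⋆ N)) ⊕ (s · a) ⊖ r · (a ⋆ N))
                                           ≡⟨ cong₂ _,_ (≡-modulo (identity (proj₁ a) _ r s (s ⁻¹)) s-inverse)
                                                        (≡-modulo (identity (proj₂ a) _ r s (s ⁻¹)) s-inverse) ⟩
      a                                    ∎
      where
      s-inverse : s * s ⁻¹ ≡ 1#
      s-inverse = ⁻¹-inverse s s-nonzero
      identity : ∀ x X r s i → i * ((r * X + s * x) - r * X) ≡ x + x * (s * i - 1#)
      identity = solve 5 (λ x X r s i → i :* ((r :* X :+ s :* x) :- r :* X) := x :+ x :* (s :* i :- :1)) refl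

    a⋆P≡e₂ : a ⋆ P ≡ e₂
    a⋆P≡e₂ = trans (sym (row₂-*ᴹ Q P)) (cong row₂ (*ᴹ-inverseʳ Q det-Q≢0))

    row₁-conjugate : row₁ (conjugate N) ≡ e₂
    row₁-conjugate = begin
      row₁ (Q *ᴹ N *ᴹ P) ≡⟨ row₁-*ᴹ (Q *ᴹ N) P ⟩
      row₁ (Q *ᴹ N) ⋆ P  ≡⟨ cong (_⋆ P) (trans (row₁-*ᴹ Q N) u⋆N≡a) ⟩
      a ⋆ P              ≡⟨ a⋆P≡e₂ ⟩
      e₂                 ∎

    direction-m : direction (slope (m₁ , m₂)) ≡ slope e₂
    direction-m = cong slope (slopeImage-m (m₂ ≟ 0#))
      where
      slopeImage-m : ∀ de → slopeImage m₁ m₂ de ≡ e₂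
      slopeImage-m (yes m₂≡0) = contradiction m₂≡0 m₂≢0
      slopeImage-m (no _)     = row₁-conjugate

  verticalising : Line → Collineation
  verticalising (line (c , _) _) = Mixing.collineation c (fpoly-nonzero c)
  verticalising (vert _)         = idᶜ

  toAxis : Line → Point → Collineation
  toAxis ℓ P₀ = verticalising ℓ ∘ᶜ translation P₀

  toAxis-origin : ∀ ℓ P₀ → Collineation.to (toAxis ℓ P₀) P₀ ≡ O
  toAxis-origin (line (c , _) _) P₀ = trans (cong (pairwise _) (translation-to-self P₀)) (pairwise-O _)
  toAxis-origin (vert _)         P₀ = translation-to-self P₀

  toAxis-baer : ∀ ℓ P₀ → InBF ℓ → Collineation.direction (toAxis ℓ P₀) (directionOf ℓ) ≡ vertical
  toAxis-baer (line (c , e) _) P₀ e≡0 = Mixing.direction-baer-c c (fpoly-nonzero c) e≡0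
  toAxis-baer (vert _)         P₀ _   = refl

  toAxis-nonBaer : ∀ ℓ P₀ {d e} → ¬ e ≡ 0# → Collineation.direction (toAxis ℓ P₀) (slope (d , e)) ≡ slope (d , e)
  toAxis-nonBaer (line (c , _) _) P₀ e≢0 = Mixing.direction-nonBaer c (fpoly-nonzero c) e≢0
  toAxis-nonBaer (vert _)         P₀ _   = refl

  proposition2p9-i : (ℓ ℓ' : Line) → InNBF ℓ → InBF ℓ' → Intersect ℓ ℓ'
         → (A : Point) → OnLine A ℓ → ¬ OnLine A ℓ'
         → Σ (Point → Point) λ φ → IsCollineation φ
             × MapsLine φ ℓ ℓ₀₁ × MapsLine φ ℓ' x=0 × φ A ≡ (e₂ , (s , r))
  proposition2p9-i (vert _) _ ()
  proposition2p9-i ℓ@(line (m₁ , m₂) k) ℓ' m₂≢0 ℓ'∈BF (P₀ , P₀∈ℓ , P₀∈ℓ') A A∈ℓ A∉ℓ' =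
    to , isCollineation , mapsLine-origin ℓ P₀∈ℓ C-P₀ C-ℓ , mapsLine-origin ℓ' P₀∈ℓ' C-P₀ C-ℓ' , C-A
    where
    module C₁ = Collineation (toAxis ℓ' P₀)
    A₁ : Point
    A₁ = C₁.to A
    C₁-ℓ : C₁.direction (slope (m₁ , m₂)) ≡ slope (m₁ , m₂)
    C₁-ℓ = toAxis-nonBaer ℓ' P₀ m₂≢0
    A₁-on-ℓ₁ : intercept (slope (m₁ , m₂)) A₁ ≡ 𝟎
    A₁-on-ℓ₁ = subst (λ d → intercept d A₁ ≡ 𝟎) C₁-ℓ (C₁.intercept-image ℓ P₀∈ℓ A∈ℓ (toAxis-origin ℓ' P₀))
    x₁≢𝟎 : ¬ proj₁ A₁ ≡ 𝟎
    x₁≢𝟎 x₁≡𝟎 = C₁.to-≢-O {ℓ'} P₀∈ℓ' A∉ℓ' (toAxis-origin ℓ' P₀) (intercept-slope-origin A₁-on-ℓ₁ x₁≡𝟎)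
    module N = Normalisation m₁ m₂ m₂≢0 (proj₁ A₁) x₁≢𝟎
    open Collineation (N.collineation ∘ᶜ toAxis ℓ' P₀)
    C-P₀ : to P₀ ≡ O
    C-P₀ = trans (cong N.conj (toAxis-origin ℓ' P₀)) N.conj-O
    C-ℓ : direction (slope (m₁ , m₂)) ≡ slope e₂
    C-ℓ = trans (cong N.direction C₁-ℓ) N.direction-m
    C-ℓ' : direction (directionOf ℓ') ≡ vertical
    C-ℓ' = cong N.direction (toAxis-baer ℓ' P₀ ℓ'∈BF)
    A-on-ℓ₀₁ : intercept (slope e₂) (to A) ≡ 𝟎
    A-on-ℓ₀₁ = subst (λ d → intercept d (to A) ≡ 𝟎) C-ℓ (intercept-image ℓ P₀∈ℓ A∈ℓ C-P₀)
    C-A : to A ≡ (e₂ , (s , r))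
    C-A = cong₂ _,_ N.a⋆P≡e₂ (trans (⊖≡𝟎⇒≡ A-on-ℓ₀₁) (trans (cong (_⊙ e₂) N.a⋆P≡e₂) e₂⊙e₂))

  proposition2p9-ii : (ℓ ℓ' : Line) → InBF ℓ → InNBF ℓ' → Intersect ℓ ℓ'
          → (A : Point) → OnLine A ℓ → ¬ OnLine A ℓ'
          → Σ (Point → Point) λ φ → IsCollineation φ
              × MapsLine φ ℓ x=0 × MapsLine φ ℓ' ℓ₀₁ × φ A ≡ (𝟎 , e₂)
  proposition2p9-ii _ (vert _) _ ()
  proposition2p9-ii ℓ ℓ'@(line (m₁ , m₂) k) ℓ∈BF m₂≢0 (P₀ , P₀∈ℓ , P₀∈ℓ') A A∈ℓ A∉ℓ' =
    to , isCollineation , mapsLine-origin ℓ P₀∈ℓ C-P₀ C-ℓ , mapsLine-origin ℓ' P₀∈ℓ' C-P₀ C-ℓ' , C-A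
    where
    module C₁ = Collineation (toAxis ℓ P₀)
    A₁ : Point
    A₁ = C₁.to A
    x₁≡𝟎 : proj₁ A₁ ≡ 𝟎
    x₁≡𝟎 = subst (λ d → intercept d A₁ ≡ 𝟎) (toAxis-baer ℓ P₀ ℓ∈BF) (C₁.intercept-image ℓ P₀∈ℓ A∈ℓ (toAxis-origin ℓ P₀))
    y₁≢𝟎 : ¬ proj₂ A₁ ≡ 𝟎
    y₁≢𝟎 y₁≡𝟎 = C₁.to-≢-O {ℓ'} P₀∈ℓ' A∉ℓ' (toAxis-origin ℓ P₀) (cong₂ _,_ x₁≡𝟎 y₁≡𝟎)
    module N = Normalisation m₁ m₂ m₂≢0 (proj₂ A₁) y₁≢𝟎
    open Collineation (N.collineation ∘ᶜ toAxis ℓ P₀)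
    C-P₀ : to P₀ ≡ O
    C-P₀ = trans (cong N.conj (toAxis-origin ℓ P₀)) N.conj-O
    C-ℓ : direction (directionOf ℓ) ≡ vertical
    C-ℓ = cong N.direction (toAxis-baer ℓ P₀ ℓ∈BF)
    C-ℓ' : direction (slope (m₁ , m₂)) ≡ slope e₂
    C-ℓ' = trans (cong N.direction (toAxis-nonBaer ℓ P₀ m₂≢0)) N.direction-m
    C-A : to A ≡ (𝟎 , e₂)
    C-A = cong₂ _,_ (trans (cong (_⋆ N.P) x₁≡𝟎) (𝟎-⋆ N.P)) N.a⋆P≡e₂

proposition2p9 : (F : FiniteField) → (r s : FiniteField.Carrier F) → Hall.Irreducible F r s
  → ((ℓ ℓ' : Hall.Line F r s) → Hall.InNBF F r s ℓ → Hall.InBF F r s ℓ' → Hall.Intersect F r s ℓ ℓ'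
      → (A : Hall.Point F r s) → Hall.OnLine F r s A ℓ → ¬ Hall.OnLine F r s A ℓ'
      → Σ (Hall.Point F r s → Hall.Point F r s) λ φ → Hall.IsCollineation F r s φ
          × Hall.MapsLine F r s φ ℓ (Hall.ℓ₀₁ F r s) × Hall.MapsLine F r s φ ℓ' (Hall.x=0 F r s)
          × φ A ≡ ((FiniteField.0# F , FiniteField.1# F) , (s , r)))
  × ((ℓ ℓ' : Hall.Line F r s) → Hall.InBF F r s ℓ → Hall.InNBF F r s ℓ' → Hall.Intersect F r s ℓ ℓ'
      → (A : Hall.Point F r s) → Hall.OnLine F r s A ℓ → ¬ Hall.OnLine F r s A ℓ'
      → Σ (Hall.Point F r s → Hall.Point F r s) λ φ → Hall.IsCollineation F r s φ
          × Hall.MapsLine F r s φ ℓ (Hall.x=0 F r s) × Hall.MapsLine F r s φ ℓ' (Hall.ℓ₀₁ F r s)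
          × φ A ≡ ((FiniteField.0# F , FiniteField.0# F) , (FiniteField.0# F , FiniteField.1# F)))
proposition2p9 F r s irreducible = proposition2p9-i , proposition2p9-ii
  where open HallCollineations F r s irreducible
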